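{- Let $q>2$ be a prime power, let $r\ge 1$, and let $(G,R)$ be a $2$-coloring of $PG(r-1,q)$. Then $PG(r-1,q)|G$ is a target if and only if $PG(r-1,q)|G$ does not contain any of $U_{2,2},U_{2,3},\dots,U_{2,q-1}$ (that is, $U_{2,m}$ for any $2\le m\le q-1$) as an induced restriction.
   Context: All matroids are simple. $PG(r-1,q)$ denotes the rank-$r$ projective geometry over $GF(q)$; its flats are called projective flats. A $2$-coloring $(G,R)$ of $PG(r-1,q)$ is a partition of $E(PG(r-1,q))$ into possibly empty sets $G$ (green) and $R$ (red). A nested sequence of projective flats is a sequence $(F_0,F_1,\dots,F_k)$ of possibly empty projective flats with $\emptyset=F_0\subseteq F_1\subseteq\dots\subseteq F_k=E(PG(r-1,q))$. For $X\subseteq E(PG(r-1,q))$, the matroid $PG(r-1,q)|X$ is a target if there is a nested sequence of projective flats $(F_0,\dots,F_k)$ such that $X$ is the union of the sets $F_{i+1}-F_i$ over all even $i$ with $0\le i\le k-1$. An induced restriction of a matroid $M$ is a restriction of $M$ to one of its flats; $M$ contains $N$ as an induced restriction if $M|F\cong N$ for some flat $F$ of $M$ (for $M=PG(r-1,q)|G$, the flats are the sets $G\cap F$ with $F$ a projective flat). -}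

module Defs where

open import Level using (Level; suc; _⊔_)
open import Data.Nat as ℕ using (ℕ; _%_)
open import Data.Fin as Fin using (Fin; toℕ; inject₁; fromℕ)
open import Data.Vec using (Vec; replicate; zipWith; map)
open import Data.Bool using (Bool; true; false)
open import Data.Product using (Σ; ∃; ∃-syntax; _×_; _,_)
open import Relation.Binary.PropositionalEquality using (_≡_; _≢_)
open import Relation.Nullary using (¬_)
open import Relation.Binary.Definitions using (DecidableEquality)
open import Algebra.Structures using (IsCommutativeRing)
open import Function.Bundles using (_↔_)

record Field (c : Level) : Set (Level.suc c) where
  infixl 6 _+_
  infixl 7 _*_
  field
    Carrier : Set c
    _+_ _*_ : Carrier → Carrier → Carrier
    -_      : Carrier → Carrier
    0# 1#   : Carrier
    isCommutativeRing : IsCommutativeRing _≡_ _+_ _*_ -_ 0# 1#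
    0≢1     : 0# ≢ 1#
    inverse : ∀ x → x ≢ 0# → ∃[ y ] (x * y ≡ 1#)
    _≟_     : DecidableEquality Carrier

-- A field with exactly q elements, i.e. (up to isomorphism) GF(q).
-- Such a field exists iff q is a prime power.
HasOrder : ∀ {c} → Field c → ℕ → Set c
HasOrder K q = Fin q ↔ Field.Carrier K

module Geometry {c} (K : Field c) (r : ℕ) where
  open Field K

  -- vectors of K^r ; the points of PG(r-1,q) are the nonzero vectors
  -- up to nonzero scalar multiples.
  V : Set c
  V = Vec Carrier r

  0v : V
  0v = replicate r 0#

  _+v_ : V → V → V
  _+v_ = zipWith _+_

  _·_ : Carrier → V → V
  a · v = map (a *_) v

  -- A 2-colouring (G,R) of PG(r-1,q): G is the set of green points,
  -- given as a Boolean predicate on nonzero vectors invariant under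
  -- nonzero scaling (so it is a predicate on projective points);
  -- R is the complement.
  record Colouring : Set c where
    field
      green     : V → Bool
      invariant : ∀ a v → a ≢ 0# → v ≢ 0v → green (a · v) ≡ green v

  -- A linear subspace of K^r; projective flats are exactly the sets of
  -- projective points of such subspaces.
  record Subspace : Set c where
    field
      member   : V → Bool
      has-0    : member 0v ≡ true
      closed-+ : ∀ u v → member u ≡ true → member v ≡ true → member (u +v v) ≡ true
      closed-· : ∀ a v → member v ≡ true → member (a · v) ≡ true
  open Subspace public

  -- PG(r-1,q)|G is a target: there is a nested sequence of projective
  -- flats ∅ = F₀ ⊆ F₁ ⊆ … ⊆ F_k = E such that G is the union of the
  -- F_{i+1} - F_i over even i.
  IsTarget : Colouring → Set c
  IsTarget col =
    Σ ℕ λ k → Σ (Fin (ℕ.suc k) → Subspace) λ W → (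
      (∀ v → member (W Fin.zero) v ≡ true → v ≡ 0v) ×
      (∀ v → member (W (fromℕ k)) v ≡ true) ×
      (∀ (i : Fin k) v → member (W (inject₁ i)) v ≡ true → member (W (Fin.suc i)) v ≡ true) ×
      (∀ v → v ≢ 0v →
        (green v ≡ true →
           Σ (Fin k) λ i → (toℕ i % 2 ≡ 0 × member (W (inject₁ i)) v ≡ false × member (W (Fin.suc i)) v ≡ true)) ×
        ((Σ (Fin k) λ i → (toℕ i % 2 ≡ 0 × member (W (inject₁ i)) v ≡ false × member (W (Fin.suc i)) v ≡ true)) →
           green v ≡ true)))
    where
      open Colouring col

  SamePoint : V → V → Set c
  SamePoint u v = ∃[ a ] (a ≢ 0# × v ≡ a · u)

  Dependent3 : V → V → V → Set c
  Dependent3 x y z = ∃[ a ] ∃[ b ] ∃[ d ]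
    (¬ (a ≡ 0# × b ≡ 0# × d ≡ 0#) × (a · x) +v ((b · y) +v (d · z)) ≡ 0v)

  -- PG(r-1,q)|G contains U_{2,m} as an induced restriction: there is a
  -- projective flat F such that (PG(r-1,q)|G)|(G ∩ F) ≅ U_{2,m}, i.e. the
  -- points of G ∩ F are enumerated bijectively by e : Fin m → points, and
  -- a set of these points is independent iff it has size ≤ 2 (pairs of
  -- distinct projective points are always independent; so this amounts to
  -- every three of them being dependent).
  HasInducedU2 : Colouring → ℕ → Set c
  HasInducedU2 col m =
    Σ Subspace λ F → Σ (Fin m → V) λ e →
      (∀ i → e i ≢ 0v × green (e i) ≡ true × member F (e i) ≡ true) ×
      (∀ i j → i ≢ j → ¬ SamePoint (e i) (e j)) ×
      (∀ v → v ≢ 0v → green v ≡ true → member F v ≡ true → ∃[ i ] SamePoint (e i) v) ×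
      (∀ i j l → i ≢ j → j ≢ l → i ≢ l → Dependent3 (e i) (e j) (e l))
    where open Colouring col

{-# OPTIONS --safe #-}
-- Call a line mixed if it carries two green and two red points. A line has q + 1 points, so it
-- meets the green set in m points with 2 ≤ m ≤ q − 1 exactly when it is mixed, and an induced
-- U_{2,m} is the green part of such a line.
--
-- In a target every line meets each flat of the chain in nothing, a point or the whole line, so
-- all its points but at most one have the same colour: no line is mixed.
--
-- Conversely, suppose no line is mixed. Then in every nonzero subspace X one colour class lies
-- in a proper subspace Z, and the target is obtained by induction on Z, putting X − Z on top.
-- To confine a colour class, project from a point p onto a hyperplane section H of X, colouring
-- a line through p green when it carries a second point of the colour of p. No line of H is
-- mixed for this colouring, so by induction one of its colour classes is confined in H. Lifting
-- back, either the colour class of p is confined in X, or every line through p outside some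
-- proper subspace Z_p repeats the colour of p. The latter cannot hold both for a green point g
-- and for a red point y ∉ Z_g: as q > 2 this produces a mixed line.
module Submission where

open import Defs
open import Algebra.Bundles using (CommutativeRing)
open import Algebra.Core using (Op₁; Op₂)
import Algebra.Solver.Ring
import Algebra.Solver.Ring.AlmostCommutativeRing as ACR
open import Algebra.Structures using (IsCommutativeRing)
open import Data.Bool as Bool using (Bool; true; false; not)
open import Data.Bool.Properties using (¬-not; not-¬; not-involutive; ⇔→≡)
open import Data.Empty using (⊥; ⊥-elim)
open import Data.Fin as Fin using (Fin; toℕ)
import Data.Fin.Properties as Fin
open import Data.Fin.Subset using (Subset; ∣_∣; ∁) renaming (_∈_ to _∈ₛ_; _⊂_ to _⊂ₛ_)
open import Data.Fin.Subset.Properties using (x∉p⇒x∈∁p; x∈∁p⇒x∉p; ∣p∣≤n; ∣∁p∣≡n∸∣p∣; p⊂q⇒∣p∣<∣q∣)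
open import Data.Integer as ℤ using (ℤ; -[1+_])
import Data.Integer.Properties as ℤ
open import Data.Maybe using (Maybe; just; nothing)
open import Data.Nat as ℕ using (ℕ; zero; suc; _≤_; _<_; _∸_; _^_; _%_)
open import Data.Nat.Induction using (<-wellFounded)
import Data.Nat.Properties as ℕ
open import Data.Product using (Σ; ∃; ∃₂; ∃-syntax; _×_; _,_; proj₁; proj₂; swap; uncurry)
open import Data.Sum using (_⊎_; inj₁; inj₂; [_,_]′)
open import Data.Unit using (⊤; tt)
open import Data.Vec using (Vec; []; _∷_; zipWith; map; replicate; lookup; tabulate; here; there)
open import Data.Vec.Properties
  using (≡-dec; lookup-zipWith; lookup-map; lookup-replicate; lookup∘tabulate; []=⇒lookup; lookup⇒[]=)
open import Function.Base using (_∘_; _on_)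
open import Function.Bundles using (_⇔_; mk⇔; Inverse)
open import Induction.WellFounded using (WellFounded; Acc; acc; module Subrelation)
open import Level using (Level)
import Relation.Binary.Construct.On as On
open import Relation.Binary.Definitions using (DecidableEquality)
open import Relation.Binary.PropositionalEquality
open import Relation.Nullary using (¬_; Dec; yes; no; does)
open import Relation.Nullary.Decidable using (map′; dec-true; dec-false; _×-dec_; ¬?; decidable-stable)

-- Solvers taking their coefficients in an abstract ring cannot decide that a coefficient such as
-- 1 + - 1 vanishes, so here the coefficients are integers, mapped into the ring by ⟦_⟧.
module IntegerRingSolver {c} {A : Set c} {add mul : Op₂ A} {neg : Op₁ A} {0r 1r : A}
  (isCommutativeRing : IsCommutativeRing _≡_ add mul neg 0r 1r) where

  commutativeRing : CommutativeRing c c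
  commutativeRing = record { isCommutativeRing = isCommutativeRing }

  open CommutativeRing commutativeRing
    using (_+_; _*_; -_; 0#; 1#; ring; semiring; +-assoc; +-comm; +-identityˡ; +-identityʳ; -‿inverseʳ)
  open import Algebra.Properties.Ring ring using (-‿distribˡ-*; -‿distribʳ-*; -‿involutive; -0#≈0#; -‿+-comm)
  open import Algebra.Properties.Semiring.Mult.TCOptimised semiring using (×-homo-+; ×1-homo-*) renaming (_×_ to _×ₙ_)
  open ≡-Reasoning

  -- With the optimised _×ₙ_, ⟦ + 1 ⟧ reduces to 1#, so :1 denotes 1# itself in solver equations.
  ⟦_⟧ : ℤ → A
  ⟦ ℤ.+ n ⟧ = n ×ₙ 1#
  ⟦ -[1+ n ] ⟧ = - (suc n ×ₙ 1#)

  private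
    cancel-1 : ∀ a b → (1# + a) + - (1# + b) ≡ a + - b
    cancel-1 a b = begin
      (1# + a) + - (1# + b)   ≡⟨ cong ((1# + a) +_) (sym (-‿+-comm 1# b)) ⟩
      (1# + a) + (- 1# + - b) ≡⟨ cong (_+ (- 1# + - b)) (+-comm 1# a) ⟩
      (a + 1#) + (- 1# + - b) ≡⟨ +-assoc a 1# _ ⟩
      a + (1# + (- 1# + - b)) ≡⟨ cong (a +_) (sym (+-assoc 1# (- 1#) (- b))) ⟩
      a + ((1# + - 1#) + - b) ≡⟨ cong (λ z → a + (z + - b)) (-‿inverseʳ 1#) ⟩
      a + (0# + - b)          ≡⟨ cong (a +_) (+-identityˡ (- b)) ⟩
      a + - b                 ∎

  ⊖-homo : ∀ m n → ⟦ m ℤ.⊖ n ⟧ ≡ m ×ₙ 1# + - (n ×ₙ 1#)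
  ⊖-homo m zero = sym (trans (cong (m ×ₙ 1# +_) -0#≈0#) (+-identityʳ _))
  ⊖-homo zero (suc n) = sym (+-identityˡ _)
  ⊖-homo (suc m) (suc n) = begin
    ⟦ suc m ℤ.⊖ suc n ⟧         ≡⟨ cong ⟦_⟧ (ℤ.[1+m]⊖[1+n]≡m⊖n m n) ⟩
    ⟦ m ℤ.⊖ n ⟧                 ≡⟨ ⊖-homo m n ⟩
    m ×ₙ 1# + - (n ×ₙ 1#)         ≡⟨ sym (cancel-1 _ _) ⟩
    (1# + m ×ₙ 1#) + - (1# + n ×ₙ 1#)
      ≡⟨ sym (cong₂ (λ a b → a + - b) (×-homo-+ 1# 1 m) (×-homo-+ 1# 1 n)) ⟩
    suc m ×ₙ 1# + - (suc n ×ₙ 1#) ∎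

  +-homo : ∀ i j → ⟦ i ℤ.+ j ⟧ ≡ ⟦ i ⟧ + ⟦ j ⟧
  +-homo (ℤ.+ m) (ℤ.+ n) = ×-homo-+ 1# m n
  +-homo (ℤ.+ m) -[1+ n ] = ⊖-homo m (suc n)
  +-homo -[1+ m ] (ℤ.+ n) = trans (⊖-homo n (suc m)) (+-comm _ _)
  +-homo -[1+ m ] -[1+ n ] = begin
    - (suc (suc (m ℕ.+ n)) ×ₙ 1#)          ≡⟨ cong (λ k → - (k ×ₙ 1#)) (sym (ℕ.+-suc (suc m) n)) ⟩
    - ((suc m ℕ.+ suc n) ×ₙ 1#)             ≡⟨ cong -_ (×-homo-+ 1# (suc m) (suc n)) ⟩
    - (suc m ×ₙ 1# + suc n ×ₙ 1#)            ≡⟨ sym (-‿+-comm _ _) ⟩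
    - (suc m ×ₙ 1#) + - (suc n ×ₙ 1#)        ∎

  -‿homo : ∀ i → ⟦ ℤ.- i ⟧ ≡ - ⟦ i ⟧
  -‿homo (ℤ.+ 0) = sym -0#≈0#
  -‿homo (ℤ.+ suc n) = refl
  -‿homo -[1+ n ] = sym (-‿involutive _)

  *-homo-+ : ∀ m j → ⟦ ℤ.+ m ℤ.* j ⟧ ≡ ⟦ ℤ.+ m ⟧ * ⟦ j ⟧
  *-homo-+ m (ℤ.+ n) = trans (cong ⟦_⟧ (sym (ℤ.pos-* m n))) (×1-homo-* m n)
  *-homo-+ m -[1+ n ] = begin
    ⟦ ℤ.+ m ℤ.* ℤ.- ℤ.+ suc n ⟧   ≡⟨ cong ⟦_⟧ (sym (ℤ.neg-distribʳ-* (ℤ.+ m) (ℤ.+ suc n))) ⟩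
    ⟦ ℤ.- (ℤ.+ m ℤ.* ℤ.+ suc n) ⟧ ≡⟨ -‿homo (ℤ.+ m ℤ.* ℤ.+ suc n) ⟩
    - ⟦ ℤ.+ m ℤ.* ℤ.+ suc n ⟧     ≡⟨ cong -_ (*-homo-+ m (ℤ.+ suc n)) ⟩
    - (⟦ ℤ.+ m ⟧ * ⟦ ℤ.+ suc n ⟧) ≡⟨ -‿distribʳ-* _ _ ⟩
    ⟦ ℤ.+ m ⟧ * ⟦ -[1+ n ] ⟧      ∎

  *-homo : ∀ i j → ⟦ i ℤ.* j ⟧ ≡ ⟦ i ⟧ * ⟦ j ⟧
  *-homo (ℤ.+ m) j = *-homo-+ m j
  *-homo -[1+ m ] j = begin
    ⟦ ℤ.- ℤ.+ suc m ℤ.* j ⟧     ≡⟨ cong ⟦_⟧ (sym (ℤ.neg-distribˡ-* (ℤ.+ suc m) j)) ⟩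
    ⟦ ℤ.- (ℤ.+ suc m ℤ.* j) ⟧   ≡⟨ -‿homo (ℤ.+ suc m ℤ.* j) ⟩
    - ⟦ ℤ.+ suc m ℤ.* j ⟧       ≡⟨ cong -_ (*-homo-+ (suc m) j) ⟩
    - (⟦ ℤ.+ suc m ⟧ * ⟦ j ⟧)   ≡⟨ -‿distribˡ-* _ _ ⟩
    ⟦ -[1+ m ] ⟧ * ⟦ j ⟧        ∎

  homomorphism : ℤ.+-*-rawRing ACR.-Raw-AlmostCommutative⟶ ACR.fromCommutativeRing commutativeRing
  homomorphism = record
    { ⟦_⟧ = ⟦_⟧ ; +-homo = +-homo ; *-homo = *-homo ; -‿homo = -‿homo
    ; 0-homo = refl ; 1-homo = refl }

  equal? : ∀ i j → Maybe (⟦ i ⟧ ≡ ⟦ j ⟧)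
  equal? i j with i ℤ.≟ j
  ... | yes i≡j = just (cong ⟦_⟧ i≡j)
  ... | no _ = nothing

  open Algebra.Solver.Ring ℤ.+-*-rawRing (ACR.fromCommutativeRing commutativeRing) homomorphism equal? public
    using (Polynomial; solve; _:=_; _:+_; _:*_; :-_; con)

  :0 :1 : ∀ {m} → Polynomial m
  :0 = con (ℤ.+ 0)
  :1 = con (ℤ.+ 1)

true≢false : true ≢ false
true≢false ()

rising-edge : (b : ℕ → Bool) → b 0 ≡ false → ∀ k → b k ≡ true →
  ∃ λ i → i < k × b i ≡ false × b (suc i) ≡ true
rising-edge b b₀ zero b-top = ⊥-elim (true≢false (trans (sym b-top) b₀))
rising-edge b b₀ (suc k) b-top with b k in bₖ
... | true = let (i , i<k , bᵢ , b₁₊ᵢ) = rising-edge b b₀ k bₖ in i , ℕ.m<n⇒m<1+n i<k , bᵢ , b₁₊ᵢ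
... | false = k , ℕ.≤-refl , bₖ , b-top

dec-true⁻ : ∀ {p} {P : Set p} (P? : Dec P) → does P? ≡ true → P
dec-true⁻ (yes p) _ = p

dec-false⁻ : ∀ {p} {P : Set p} (P? : Dec P) → does P? ≡ false → ¬ P
dec-false⁻ (no ¬p) _ = ¬p

any?-onto : ∀ {a p n} {A : Set a} {P : A → Set p} (e : Fin n → A) → (∀ x → ∃ λ i → e i ≡ x) →
  (∀ x → Dec (P x)) → Dec (∃ P)
any?-onto {P = P} e e-onto P? = map′ (λ (i , Pei) → e i , Pei) found (Fin.any? (λ i → P? (e i)))
  where
  found : ∃ P → ∃ λ i → P (e i)
  found (x , Px) = let (i , ei≡x) = e-onto x in i , subst P (sym ei≡x) Px

distinct⇒2≤ : ∀ {n} (i j : Fin n) → i ≢ j → 2 ≤ n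
distinct⇒2≤ {suc zero} Fin.zero Fin.zero i≢j = ⊥-elim (i≢j refl)
distinct⇒2≤ {suc (suc n)} _ _ _ = ℕ.s≤s (ℕ.s≤s ℕ.z≤n)

2≤⇒distinct : ∀ {n} → 2 ≤ n → ∃₂ λ (i j : Fin n) → i ≢ j
2≤⇒distinct (ℕ.s≤s (ℕ.s≤s _)) = Fin.zero , Fin.suc Fin.zero , λ ()

enumerate : ∀ {n} (p : Subset n) → Fin ∣ p ∣ → Fin n
enumerate (true ∷ p) Fin.zero = Fin.zero
enumerate (true ∷ p) (Fin.suc i) = Fin.suc (enumerate p i)
enumerate (false ∷ p) i = Fin.suc (enumerate p i)

enumerate-∈ : ∀ {n} (p : Subset n) i → enumerate p i ∈ₛ p
enumerate-∈ (true ∷ p) Fin.zero = here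
enumerate-∈ (true ∷ p) (Fin.suc i) = there (enumerate-∈ p i)
enumerate-∈ (false ∷ p) i = there (enumerate-∈ p i)

enumerate-injective : ∀ {n} (p : Subset n) {i j} → enumerate p i ≡ enumerate p j → i ≡ j
enumerate-injective (true ∷ p) {Fin.zero} {Fin.zero} _ = refl
enumerate-injective (true ∷ p) {Fin.suc i} {Fin.suc j} eq = cong Fin.suc (enumerate-injective p (Fin.suc-injective eq))
enumerate-injective (false ∷ p) eq = enumerate-injective p (Fin.suc-injective eq)

enumerate-onto : ∀ {n} (p : Subset n) {x} → x ∈ₛ p → ∃ λ i → enumerate p i ≡ x
enumerate-onto (true ∷ p) here = Fin.zero , refl
enumerate-onto (true ∷ p) (there x∈p) = let (i , eq) = enumerate-onto p x∈p in Fin.suc i , cong Fin.suc eq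
enumerate-onto (false ∷ p) (there x∈p) = let (i , eq) = enumerate-onto p x∈p in i , cong Fin.suc eq

two≤∣_∣ : ∀ {n} (p : Subset n) {x y} → x ∈ₛ p → y ∈ₛ p → x ≢ y → 2 ≤ ∣ p ∣
two≤∣ p ∣ x∈p y∈p x≢y with enumerate-onto p x∈p | enumerate-onto p y∈p
... | i , refl | j , refl = distinct⇒2≤ i j (λ i≡j → x≢y (cong (enumerate p) i≡j))

∣p∣+∣∁p∣ : ∀ {n} (p : Subset n) → ∣ p ∣ ℕ.+ ∣ ∁ p ∣ ≡ n
∣p∣+∣∁p∣ p = trans (cong (∣ p ∣ ℕ.+_) (∣∁p∣≡n∸∣p∣ p)) (ℕ.m+[n∸m]≡n (∣p∣≤n p))

module FieldProperties {c} (K : Field c) where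

  open Field K public
  open IntegerRingSolver isCommutativeRing public using (solve; _:=_; _:+_; _:*_; :-_; :0; :1)
  open IntegerRingSolver isCommutativeRing using (commutativeRing)
  open CommutativeRing commutativeRing public
    using (*-comm; *-assoc; *-identityˡ; *-identityʳ; zeroˡ; zeroʳ; +-identityˡ; +-identityʳ)
  open ≡-Reasoning

  F : Set c
  F = Carrier

  1≢0 : 1# ≢ 0#
  1≢0 1≡0 = 0≢1 (sym 1≡0)

  inv : (a : F) → a ≢ 0# → F
  inv a a≢0 = proj₁ (inverse a a≢0)

  *-inverseʳ : ∀ a (a≢0 : a ≢ 0#) → a * inv a a≢0 ≡ 1#
  *-inverseʳ a a≢0 = proj₂ (inverse a a≢0)

  *-inverseˡ : ∀ a (a≢0 : a ≢ 0#) → inv a a≢0 * a ≡ 1#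
  *-inverseˡ a a≢0 = trans (*-comm _ a) (*-inverseʳ a a≢0)

  *-cancelˡ : ∀ {a b} → a ≢ 0# → a * b ≡ 0# → b ≡ 0#
  *-cancelˡ {a} {b} a≢0 ab≡0 = begin
    b              ≡⟨ sym (*-identityˡ b) ⟩
    1# * b         ≡⟨ cong (_* b) (sym (*-inverseˡ a a≢0)) ⟩
    inv a a≢0 * a * b   ≡⟨ *-assoc _ a b ⟩
    inv a a≢0 * (a * b) ≡⟨ cong (inv a a≢0 *_) ab≡0 ⟩
    inv a a≢0 * 0#      ≡⟨ zeroʳ _ ⟩
    0#             ∎

  *-≢0 : ∀ {a b} → a ≢ 0# → b ≢ 0# → a * b ≢ 0#
  *-≢0 a≢0 b≢0 ab≡0 = b≢0 (*-cancelˡ a≢0 ab≡0)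

  inv-≢0 : ∀ a (a≢0 : a ≢ 0#) → inv a a≢0 ≢ 0#
  inv-≢0 a a≢0 a⁻¹≡0 = 1≢0 (trans (sym (*-inverseʳ a a≢0)) (trans (cong (a *_) a⁻¹≡0) (zeroʳ a)))

  ≡-from-difference : ∀ {a b} → a + - b ≡ 0# → a ≡ b
  ≡-from-difference {a} {b} a-b≡0 = begin
    a               ≡⟨ solve 2 (λ a b → a := (a :+ :- b) :+ b) refl a b ⟩
    (a + - b) + b   ≡⟨ cong (_+ b) a-b≡0 ⟩
    0# + b          ≡⟨ +-identityˡ b ⟩
    b               ∎

  difference-≢0 : ∀ {a b} → a ≢ b → a + - b ≢ 0#
  difference-≢0 a≢b a-b≡0 = a≢b (≡-from-difference a-b≡0)

  -‿≡0 : ∀ {a} → - a ≡ 0# → a ≡ 0#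
  -‿≡0 {a} -a≡0 = begin
    a       ≡⟨ solve 1 (λ a → a := :- (:- a)) refl a ⟩
    - (- a) ≡⟨ cong -_ -a≡0 ⟩
    - 0#    ≡⟨ solve 0 (:- :0 := :0) refl ⟩
    0#      ∎

module Vectors {c} (K : Field c) where

  open FieldProperties K
  open ≡-Reasoning

  private variable n : ℕ

  infixl 6 _+v_
  infixr 7 _·_
  infix 4 _≟v_

  _+v_ : Vec F n → Vec F n → Vec F n
  _+v_ = zipWith _+_

  _·_ : F → Vec F n → Vec F n
  a · v = map (a *_) v

  0v : Vec F n
  0v = replicate _ 0#

  _≟v_ : DecidableEquality (Vec F n)
  _≟v_ = ≡-dec _≟_

  ·-assoc : ∀ a b (v : Vec F n) → a · (b · v) ≡ (a * b) · v
  ·-assoc a b [] = refl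
  ·-assoc a b (x ∷ v) = cong₂ _∷_ (sym (*-assoc a b x)) (·-assoc a b v)

  ·-identity : (v : Vec F n) → 1# · v ≡ v
  ·-identity [] = refl
  ·-identity (x ∷ v) = cong₂ _∷_ (*-identityˡ x) (·-identity v)

  ·-zero : ∀ a → a · 0v {n} ≡ 0v
  ·-zero {zero} a = refl
  ·-zero {suc n} a = cong₂ _∷_ (zeroʳ a) (·-zero a)

  0· : (v : Vec F n) → 0# · v ≡ 0v
  0· [] = refl
  0· (x ∷ v) = cong₂ _∷_ (zeroˡ x) (0· v)

  +v-identityˡ : (v : Vec F n) → 0v +v v ≡ v
  +v-identityˡ [] = refl
  +v-identityˡ (x ∷ v) = cong₂ _∷_ (+-identityˡ x) (+v-identityˡ v)

  +v-identityʳ : (v : Vec F n) → v +v 0v ≡ v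
  +v-identityʳ [] = refl
  +v-identityʳ (x ∷ v) = cong₂ _∷_ (+-identityʳ x) (+v-identityʳ v)

  +v-comm : (u v : Vec F n) → u +v v ≡ v +v u
  +v-comm [] [] = refl
  +v-comm (x ∷ u) (y ∷ v) = cong₂ _∷_ (solve 2 (λ x y → x :+ y := y :+ x) refl x y) (+v-comm u v)

  +v-inverseʳ : (v : Vec F n) → v +v (- 1#) · v ≡ 0v
  +v-inverseʳ [] = refl
  +v-inverseʳ (x ∷ v) = cong₂ _∷_ (solve 1 (λ x → x :+ (:- :1) :* x := :0) refl x) (+v-inverseʳ v)

  ·-cancel : ∀ {a} {v : Vec F n} (a≢0 : a ≢ 0#) → a · v ≡ 0v → v ≡ 0v
  ·-cancel {a = a} {v} a≢0 av≡0 = begin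
    v                       ≡⟨ sym (·-identity v) ⟩
    1# · v                  ≡⟨ cong (_· v) (sym (*-inverseˡ a a≢0)) ⟩
    (inv a a≢0 * a) · v     ≡⟨ sym (·-assoc _ a v) ⟩
    inv a a≢0 · (a · v)     ≡⟨ cong (inv a a≢0 ·_) av≡0 ⟩
    inv a a≢0 · 0v          ≡⟨ ·-zero _ ⟩
    0v                      ∎

  ·-solve : ∀ {a} {v w : Vec F n} (a≢0 : a ≢ 0#) → a · v ≡ w → v ≡ inv a a≢0 · w
  ·-solve {a = a} {v} {w} a≢0 av≡w = begin
    v                       ≡⟨ sym (·-identity v) ⟩
    1# · v                  ≡⟨ cong (_· v) (sym (*-inverseˡ a a≢0)) ⟩
    (inv a a≢0 * a) · v     ≡⟨ sym (·-assoc _ a v) ⟩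
    inv a a≢0 · (a · v)     ≡⟨ cong (inv a a≢0 ·_) av≡w ⟩
    inv a a≢0 · w           ∎

  lincomb-0ʳ : ∀ a (x y : Vec F n) → a · x +v 0# · y ≡ a · x
  lincomb-0ʳ a x y = trans (cong (a · x +v_) (0· y)) (+v-identityʳ (a · x))

  lincomb-1-0 : (x y : Vec F n) → 1# · x +v 0# · y ≡ x
  lincomb-1-0 x y = trans (lincomb-0ʳ 1# x y) (·-identity x)

  lincomb-0-1 : (x y : Vec F n) → 0# · x +v 1# · y ≡ y
  lincomb-0-1 [] [] = refl
  lincomb-0-1 (x ∷ xs) (y ∷ ys) =
    cong₂ _∷_ (solve 2 (λ x y → :0 :* x :+ :1 :* y := y) refl x y) (lincomb-0-1 xs ys)

  lincomb-0-0 : (x y : Vec F n) → 0# · x +v 0# · y ≡ 0v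
  lincomb-0-0 x y = trans (lincomb-0ʳ 0# x y) (0· x)

  lincomb-lincomb : ∀ l m a b d e (x y : Vec F n) →
    l · (a · x +v b · y) +v m · (d · x +v e · y) ≡ (l * a + m * d) · x +v (l * b + m * e) · y
  lincomb-lincomb l m a b d e [] [] = refl
  lincomb-lincomb l m a b d e (x ∷ xs) (y ∷ ys) = cong₂ _∷_
    (solve 8 (λ l m a b d e x y → l :* (a :* x :+ b :* y) :+ m :* (d :* x :+ e :* y)
                                  := (l :* a :+ m :* d) :* x :+ (l :* b :+ m :* e) :* y) refl l m a b d e x y)
    (lincomb-lincomb l m a b d e xs ys)

  ·-lincomb : ∀ s a b (x y : Vec F n) → s · (a · x +v b · y) ≡ (s * a) · x +v (s * b) · y
  ·-lincomb s a b [] [] = refl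
  ·-lincomb s a b (x ∷ xs) (y ∷ ys) = cong₂ _∷_
    (solve 5 (λ s a b x y → s :* (a :* x :+ b :* y) := (s :* a) :* x :+ (s :* b) :* y) refl s a b x y)
    (·-lincomb s a b xs ys)

  lincomb-+v : ∀ a b a′ b′ (x y : Vec F n) →
    (a · x +v b · y) +v (a′ · x +v b′ · y) ≡ (a + a′) · x +v (b + b′) · y
  lincomb-+v a b a′ b′ [] [] = refl
  lincomb-+v a b a′ b′ (x ∷ xs) (y ∷ ys) = cong₂ _∷_
    (solve 6 (λ a b a′ b′ x y → (a :* x :+ b :* y) :+ (a′ :* x :+ b′ :* y) := (a :+ a′) :* x :+ (b :+ b′) :* y)
       refl a b a′ b′ x y)
    (lincomb-+v a b a′ b′ xs ys)

  lincomb-difference : ∀ a b a′ b′ (x y : Vec F n) →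
    (a + - a′) · x +v (b + - b′) · y ≡ (a · x +v b · y) +v (- 1#) · (a′ · x +v b′ · y)
  lincomb-difference a b a′ b′ [] [] = refl
  lincomb-difference a b a′ b′ (x ∷ xs) (y ∷ ys) = cong₂ _∷_
    (solve 6 (λ a b a′ b′ x y → (a :+ :- a′) :* x :+ (b :+ :- b′) :* y
                                := (a :* x :+ b :* y) :+ (:- :1) :* (a′ :* x :+ b′ :* y)) refl a b a′ b′ x y)
    (lincomb-difference a b a′ b′ xs ys)

  lincomb-isolate : ∀ a b (x y : Vec F n) → b · y ≡ (- a) · x +v (a · x +v b · y)
  lincomb-isolate a b [] [] = refl
  lincomb-isolate a b (x ∷ xs) (y ∷ ys) = cong₂ _∷_
    (solve 4 (λ a b x y → b :* y := (:- a) :* x :+ (a :* x :+ b :* y)) refl a b x y)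
    (lincomb-isolate a b xs ys)

  lincomb-shift : ∀ a b t (x y : Vec F n) → a · x +v b · (y +v t · x) ≡ (a + b * t) · x +v b · y
  lincomb-shift a b t [] [] = refl
  lincomb-shift a b t (x ∷ xs) (y ∷ ys) = cong₂ _∷_
    (solve 5 (λ a b t x y → a :* x :+ b :* (y :+ t :* x) := (a :+ b :* t) :* x :+ b :* y) refl a b t x y)
    (lincomb-shift a b t xs ys)

  lincomb-dependency : ∀ a b (x y : Vec F n) → a · x +v (b · y +v (- 1#) · (a · x +v b · y)) ≡ 0v
  lincomb-dependency a b [] [] = refl
  lincomb-dependency a b (x ∷ xs) (y ∷ ys) = cong₂ _∷_
    (solve 4 (λ a b x y → a :* x :+ (b :* y :+ (:- :1) :* (a :* x :+ b :* y)) := :0) refl a b x y)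
    (lincomb-dependency a b xs ys)

  affine-lincomb : ∀ t (x y : Vec F n) → y +v t · x ≡ t · x +v 1# · y
  affine-lincomb t [] [] = refl
  affine-lincomb t (x ∷ xs) (y ∷ ys) =
    cong₂ _∷_ (solve 3 (λ t x y → y :+ t :* x := t :* x :+ :1 :* y) refl t x y) (affine-lincomb t xs ys)

  affine-0 : (v p : Vec F n) → v +v 0# · p ≡ v
  affine-0 v p = trans (cong (v +v_) (0· p)) (+v-identityʳ v)

  affine-shift : ∀ s t (v p : Vec F n) → (v +v s · p) +v t · p ≡ v +v (s + t) · p
  affine-shift s t [] [] = refl
  affine-shift s t (v ∷ vs) (p ∷ ps) = cong₂ _∷_
    (solve 4 (λ s t v p → (v :+ s :* p) :+ t :* p := v :+ (s :+ t) :* p) refl s t v p)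
    (affine-shift s t vs ps)

  affine-cancel : ∀ s (v p : Vec F n) → (v +v s · p) +v (- s) · p ≡ v
  affine-cancel s v p = begin
    (v +v s · p) +v (- s) · p ≡⟨ affine-shift s (- s) v p ⟩
    v +v (s + - s) · p        ≡⟨ cong (λ t → v +v t · p) (solve 1 (λ s → s :+ :- s := :0) refl s) ⟩
    v +v 0# · p               ≡⟨ affine-0 v p ⟩
    v                         ∎

  affine-+v : ∀ s t (u v p : Vec F n) → (u +v s · p) +v (v +v t · p) ≡ (u +v v) +v (s + t) · p
  affine-+v s t [] [] [] = refl
  affine-+v s t (u ∷ us) (v ∷ vs) (p ∷ ps) = cong₂ _∷_
    (solve 5 (λ s t u v p → (u :+ s :* p) :+ (v :+ t :* p) := (u :+ v) :+ (s :+ t) :* p) refl s t u v p)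
    (affine-+v s t us vs ps)

  ·-affine : ∀ a t (v p : Vec F n) → a · (v +v t · p) ≡ a · v +v (a * t) · p
  ·-affine a t [] [] = refl
  ·-affine a t (v ∷ vs) (p ∷ ps) = cong₂ _∷_
    (solve 4 (λ a t v p → a :* (v :+ t :* p) := a :* v :+ (a :* t) :* p) refl a t v p)
    (·-affine a t vs ps)

  affine-swap : ∀ s t (x y g : Vec F n) → (x +v s · y) +v t · g ≡ (x +v t · g) +v s · y
  affine-swap s t [] [] [] = refl
  affine-swap s t (x ∷ xs) (y ∷ ys) (g ∷ gs) = cong₂ _∷_
    (solve 5 (λ s t x y g → (x :+ s :* y) :+ t :* g := (x :+ t :* g) :+ s :* y) refl s t x y g)
    (affine-swap s t xs ys gs)

  affine-difference : ∀ a b (x y : Vec F n) → (x +v a · y) +v (- 1#) · (x +v b · y) ≡ (a + - b) · y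
  affine-difference a b [] [] = refl
  affine-difference a b (x ∷ xs) (y ∷ ys) = cong₂ _∷_
    (solve 4 (λ a b x y → (x :+ a :* y) :+ (:- :1) :* (x :+ b :* y) := (a :+ :- b) :* y) refl a b x y)
    (affine-difference a b xs ys)

  lincomb-affine : ∀ a b u u′ (g x : Vec F n) →
    a · (x +v u · g) +v b · (x +v u′ · g) ≡ (a * u + b * u′) · g +v (a + b) · x
  lincomb-affine a b u u′ [] [] = refl
  lincomb-affine a b u u′ (g ∷ gs) (x ∷ xs) = cong₂ _∷_
    (solve 6 (λ a b u u′ g x → a :* (x :+ u :* g) :+ b :* (x :+ u′ :* g) := (a :* u :+ b :* u′) :* g :+ (a :+ b) :* x)
       refl a b u u′ g x)
    (lincomb-affine a b u u′ gs xs)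

  lincomb-affine₂ : ∀ a b s t (u v p : Vec F n) →
    a · (u +v s · p) +v b · (v +v t · p) ≡ (a · u +v b · v) +v (a * s + b * t) · p
  lincomb-affine₂ a b s t [] [] [] = refl
  lincomb-affine₂ a b s t (u ∷ us) (v ∷ vs) (p ∷ ps) = cong₂ _∷_
    (solve 7 (λ a b s t u v p → a :* (u :+ s :* p) :+ b :* (v :+ t :* p) := (a :* u :+ b :* v) :+ (a :* s :+ b :* t) :* p)
       refl a b s t u v p)
    (lincomb-affine₂ a b s t us vs ps)

  lookup-affine : ∀ t (v p : Vec F n) i → lookup (v +v t · p) i ≡ lookup v i + t * lookup p i
  lookup-affine t v p i = trans (lookup-zipWith _+_ i v (t · p)) (cong (lookup v i +_) (lookup-map i (t *_) p))

  nonzero-coordinate : (v : Vec F n) → v ≢ 0v → ∃ λ i → lookup v i ≢ 0#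
  nonzero-coordinate [] []≢0 = ⊥-elim ([]≢0 refl)
  nonzero-coordinate (x ∷ v) x∷v≢0 with x ≟ 0#
  ... | no x≢0 = Fin.zero , x≢0
  ... | yes refl = let (i , vᵢ≢0) = nonzero-coordinate v (x∷v≢0 ∘ cong (0# ∷_)) in Fin.suc i , vᵢ≢0

module Independence {c} (K : Field c) (r : ℕ) where

  open FieldProperties K
  open Vectors K
  open Geometry K r using (V; SamePoint; Dependent3)
  open ≡-Reasoning

  Indep : V → V → Set c
  Indep x y = ∀ a b → a · x +v b · y ≡ 0v → a ≡ 0# × b ≡ 0#

  infix 4 _∈⟨_,_⟩
  _∈⟨_,_⟩ : V → V → V → Set c
  v ∈⟨ x , y ⟩ = ∃₂ λ a b → v ≡ a · x +v b · y

  ∈⟨⟩-left : ∀ x y → x ∈⟨ x , y ⟩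
  ∈⟨⟩-left x y = 1# , 0# , sym (lincomb-1-0 x y)

  ∈⟨⟩-right : ∀ x y → y ∈⟨ x , y ⟩
  ∈⟨⟩-right x y = 0# , 1# , sym (lincomb-0-1 x y)

  ∈⟨⟩-shiftˡ : ∀ x y t → y +v t · x ∈⟨ x , y ⟩
  ∈⟨⟩-shiftˡ x y t = t , 1# , affine-lincomb t x y

  ∈⟨⟩-shiftʳ : ∀ x y t → x +v t · y ∈⟨ x , y ⟩
  ∈⟨⟩-shiftʳ x y t = 1# , t , trans (affine-lincomb t y x) (+v-comm _ _)

  Indep-coefficients : ∀ {x y a b a′ b′} → Indep x y →
    a · x +v b · y ≡ a′ · x +v b′ · y → a ≡ a′ × b ≡ b′
  Indep-coefficients {x} {y} {a} {b} {a′} {b′} I same =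
    let (a-a′≡0 , b-b′≡0) = I (a + - a′) (b + - b′) (begin
          (a + - a′) · x +v (b + - b′) · y                ≡⟨ lincomb-difference a b a′ b′ x y ⟩
          (a · x +v b · y) +v (- 1#) · (a′ · x +v b′ · y)   ≡⟨ cong (_+v (- 1#) · (a′ · x +v b′ · y)) same ⟩
          (a′ · x +v b′ · y) +v (- 1#) · (a′ · x +v b′ · y) ≡⟨ +v-inverseʳ _ ⟩
          0v                                              ∎)
    in ≡-from-difference a-a′≡0 , ≡-from-difference b-b′≡0

  Indep-nonzeroˡ : ∀ {x y} → Indep x y → x ≢ 0v
  Indep-nonzeroˡ {x} {y} I x≡0 = 1≢0 (proj₁ (I 1# 0# (trans (lincomb-1-0 x y) x≡0)))

  Indep-sym : ∀ {x y} → Indep x y → Indep y x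
  Indep-sym {x} {y} I a b ay+bx≡0 = swap (I b a (trans (+v-comm (b · x) (a · y)) ay+bx≡0))

  Indep-nonzeroʳ : ∀ {x y} → Indep x y → y ≢ 0v
  Indep-nonzeroʳ I = Indep-nonzeroˡ (Indep-sym I)

  Indep⇒¬SamePoint : ∀ {x y} → Indep x y → ¬ SamePoint x y
  Indep⇒¬SamePoint {x} {y} I (s , _ , y≡sx) = 0≢1 (proj₂ (Indep-coefficients I (begin
    s · x +v 0# · y   ≡⟨ lincomb-0ʳ s x y ⟩
    s · x             ≡⟨ sym y≡sx ⟩
    y                 ≡⟨ sym (lincomb-0-1 x y) ⟩
    0# · x +v 1# · y  ∎)))

  ¬SamePoint⇒Indep : ∀ {x y} → x ≢ 0v → y ≢ 0v → ¬ SamePoint x y → Indep x y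
  ¬SamePoint⇒Indep {x} {y} x≢0 y≢0 ¬same a b ax+by≡0 with b ≟ 0# | a ≟ 0#
  ... | yes b≡0 | yes a≡0 = a≡0 , b≡0
  ... | yes refl | no a≢0 = ⊥-elim (x≢0 (·-cancel a≢0 (trans (sym (lincomb-0ʳ a x y)) ax+by≡0)))
  ... | no b≢0 | _ = ⊥-elim (¬same (s , s≢0 , y≡sx))
    where
    s = inv b b≢0 * - a
    y≡sx : y ≡ s · x
    y≡sx = begin
      y                        ≡⟨ ·-solve b≢0 (begin
        b · y                        ≡⟨ lincomb-isolate a b x y ⟩
        (- a) · x +v (a · x +v b · y) ≡⟨ cong ((- a) · x +v_) ax+by≡0 ⟩
        (- a) · x +v 0v               ≡⟨ +v-identityʳ _ ⟩
        (- a) · x                     ∎) ⟩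
      inv b b≢0 · ((- a) · x)  ≡⟨ ·-assoc _ _ x ⟩
      s · x                    ∎
    s≢0 : s ≢ 0#
    s≢0 s≡0 = y≢0 (trans y≡sx (trans (cong (_· x) s≡0) (0· x)))

  Indep-shift : ∀ {x y} t → Indep x y → Indep x (y +v t · x)
  Indep-shift {x} {y} t I a b ax+b[y+tx]≡0 =
    let (a+bt≡0 , b≡0) = I (a + b * t) b (trans (sym (lincomb-shift a b t x y)) ax+b[y+tx]≡0)
    in trans (sym (a+0t a t)) (subst (λ b → a + b * t ≡ 0#) b≡0 a+bt≡0) , b≡0
    where
    a+0t : ∀ a t → a + 0# * t ≡ a
    a+0t = solve 2 (λ a t → a :+ :0 :* t := a) refl

  Indep-affine : ∀ {g x u u′} → Indep g x → u ≢ u′ → Indep (x +v u · g) (x +v u′ · g)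
  Indep-affine {g} {x} {u} {u′} I u≢u′ a b combination≡0 = a≡0 , b≡0
    where
    vanish = I (a * u + b * u′) (a + b) (trans (sym (lincomb-affine a b u u′ g x)) combination≡0)
    a≡0 : a ≡ 0#
    a≡0 = *-cancelˡ (difference-≢0 u≢u′) (begin
      (u + - u′) * a                          ≡⟨ solve 4 (λ a b u u′ → (u :+ :- u′) :* a
                                                   := (a :* u :+ b :* u′) :+ :- ((a :+ b) :* u′)) refl a b u u′ ⟩
      (a * u + b * u′) + - ((a + b) * u′)     ≡⟨ cong₂ (λ s t → s + - (t * u′)) (proj₁ vanish) (proj₂ vanish) ⟩
      0# + - (0# * u′)                        ≡⟨ solve 1 (λ u′ → :0 :+ :- (:0 :* u′) := :0) refl u′ ⟩
      0#                                      ∎)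
    b≡0 : b ≡ 0#
    b≡0 = begin
      b             ≡⟨ solve 2 (λ a b → b := (a :+ b) :+ :- a) refl a b ⟩
      (a + b) + - a ≡⟨ cong₂ (λ s t → s + - t) (proj₂ vanish) a≡0 ⟩
      0# + - 0#     ≡⟨ solve 0 (:0 :+ :- :0 := :0) refl ⟩
      0#            ∎

  determinant-≢0 : ∀ {x y α β γ δ} → Indep (α · x +v β · y) (γ · x +v δ · y) →
    α * δ + - (β * γ) ≢ 0#
  determinant-≢0 {x} {y} {α} {β} {γ} {δ} I D≡0 = Indep-nonzeroˡ I (begin
    α · x +v β · y   ≡⟨ cong₂ (λ a b → a · x +v b · y) α≡0 β≡0 ⟩
    0# · x +v 0# · y ≡⟨ lincomb-0-0 x y ⟩
    0v               ∎)
    where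
    u₁ = α · x +v β · y
    u₂ = γ · x +v δ · y
    combine : ∀ l m → l * α + m * γ ≡ 0# → l * β + m * δ ≡ 0# → l ≡ 0# × m ≡ 0#
    combine l m first second = I l m (begin
      l · u₁ +v m · u₂                             ≡⟨ lincomb-lincomb l m α β γ δ x y ⟩
      (l * α + m * γ) · x +v (l * β + m * δ) · y   ≡⟨ cong₂ (λ a b → a · x +v b · y) first second ⟩
      0# · x +v 0# · y                             ≡⟨ lincomb-0-0 x y ⟩
      0v                                           ∎)
    δ,-β = combine δ (- β)
      (trans (solve 4 (λ α β γ δ → δ :* α :+ (:- β) :* γ := α :* δ :+ :- (β :* γ)) refl α β γ δ) D≡0)
      (solve 2 (λ β δ → δ :* β :+ (:- β) :* δ := :0) refl β δ)
    -γ,α = combine (- γ) α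
      (solve 2 (λ α γ → (:- γ) :* α :+ α :* γ := :0) refl α γ)
      (trans (solve 4 (λ α β γ δ → (:- γ) :* β :+ α :* δ := α :* δ :+ :- (β :* γ)) refl α β γ δ) D≡0)
    α≡0 = proj₂ -γ,α
    β≡0 = -‿≡0 (proj₂ δ,-β)

  span-exchange : ∀ {x y u₁ u₂ v} → Indep u₁ u₂ →
    u₁ ∈⟨ x , y ⟩ → u₂ ∈⟨ x , y ⟩ → v ∈⟨ x , y ⟩ → v ∈⟨ u₁ , u₂ ⟩
  span-exchange {x} {y} I (α , β , refl) (γ , δ , refl) (a , b , refl) = A , B , (begin
    a · x +v b · y                                 ≡⟨ cong₂ (λ s t → s · x +v t · y) (sym first) (sym second) ⟩
    (A * α + B * γ) · x +v (A * β + B * δ) · y     ≡⟨ sym (lincomb-lincomb A B α β γ δ x y) ⟩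
    A · (α · x +v β · y) +v B · (γ · x +v δ · y)   ∎)
    where
    D = α * δ + - (β * γ)
    D⁻¹ = inv D (determinant-≢0 I)
    D⁻¹D≡1 = *-inverseˡ D (determinant-≢0 I)
    A = (a * δ + - (b * γ)) * D⁻¹
    B = (b * α + - (a * β)) * D⁻¹
    first : A * α + B * γ ≡ a
    first = begin
      A * α + B * γ
        ≡⟨ solve 7 (λ a b α β γ δ i → (a :* δ :+ :- (b :* γ)) :* i :* α :+ (b :* α :+ :- (a :* β)) :* i :* γ
                                       := a :* (i :* (α :* δ :+ :- (β :* γ)))) refl a b α β γ δ D⁻¹ ⟩
      a * (D⁻¹ * D)   ≡⟨ cong (a *_) D⁻¹D≡1 ⟩
      a * 1#          ≡⟨ *-identityʳ a ⟩
      a               ∎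
    second : A * β + B * δ ≡ b
    second = begin
      A * β + B * δ
        ≡⟨ solve 7 (λ a b α β γ δ i → (a :* δ :+ :- (b :* γ)) :* i :* β :+ (b :* α :+ :- (a :* β)) :* i :* δ
                                       := b :* (i :* (α :* δ :+ :- (β :* γ)))) refl a b α β γ δ D⁻¹ ⟩
      b * (D⁻¹ * D)   ≡⟨ cong (b *_) D⁻¹D≡1 ⟩
      b * 1#          ≡⟨ *-identityʳ b ⟩
      b               ∎

  span-dependent : ∀ {x y z} → z ∈⟨ x , y ⟩ → Dependent3 x y z
  span-dependent {x} {y} (a , b , refl) =
    a , b , - 1# , (λ (_ , _ , -1≡0) → 1≢0 (-‿≡0 -1≡0)) , lincomb-dependency a b x y

  SamePoint-trans : ∀ {u v w} → SamePoint u v → SamePoint u w → SamePoint v w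
  SamePoint-trans {u} (a , a≢0 , refl) (b , b≢0 , refl) = b * inv a a≢0 , *-≢0 b≢0 (inv-≢0 a a≢0) , (begin
    b · u                       ≡⟨ cong (_· u) (sym b[a⁻¹a]≡b) ⟩
    (b * inv a a≢0 * a) · u     ≡⟨ sym (·-assoc _ a u) ⟩
    (b * inv a a≢0) · (a · u)   ∎)
    where
    b[a⁻¹a]≡b : b * inv a a≢0 * a ≡ b
    b[a⁻¹a]≡b = trans (*-assoc b _ a) (trans (cong (b *_) (*-inverseˡ a a≢0)) (*-identityʳ b))

module ColouredSubspaces {c} (K : Field c) (r : ℕ) where

  open FieldProperties K
  open Vectors K
  open Independence K r
  open Geometry K r using (V; Colouring; Subspace; member; has-0; closed-+; closed-·; SamePoint)

  infix 4 _∈_ _∉_ _⊆_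

  _∈_ _∉_ : V → Subspace → Set
  v ∈ X = member X v ≡ true
  v ∉ X = member X v ≡ false

  _⊆_ : Subspace → Subspace → Set c
  Y ⊆ X = ∀ {v} → v ∈ Y → v ∈ X

  ∈⇒¬∉ : ∀ {X v} → v ∈ X → ¬ v ∉ X
  ∈⇒¬∉ = not-¬

  ¬∈⇒∉ : ∀ {X v} → ¬ v ∈ X → v ∉ X
  ¬∈⇒∉ = ¬-not

  ∉-⊆ : ∀ {Y X v} → Y ⊆ X → v ∉ X → v ∉ Y
  ∉-⊆ {Y} {X} Y⊆X v∉X = ¬∈⇒∉ {Y} (λ v∈Y → ∈⇒¬∉ {X} (Y⊆X v∈Y) v∉X)

  ∈-lincomb : ∀ X {x y} a b → x ∈ X → y ∈ X → a · x +v b · y ∈ X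
  ∈-lincomb X a b x∈X y∈X = closed-+ X _ _ (closed-· X a _ x∈X) (closed-· X b _ y∈X)

  affine-∈ : ∀ Z {x g} t → x ∈ Z → g ∈ Z → x +v t · g ∈ Z
  affine-∈ Z t x∈Z g∈Z = closed-+ Z _ _ x∈Z (closed-· Z t _ g∈Z)

  affine-∉ : ∀ Z {x g} t → x ∉ Z → g ∈ Z → x +v t · g ∉ Z
  affine-∉ Z {x} {g} t x∉Z g∈Z = ¬∈⇒∉ {Z} λ x+tg∈Z →
    ∈⇒¬∉ {Z} (subst (_∈ Z) (affine-cancel t x g) (affine-∈ Z (- t) x+tg∈Z g∈Z)) x∉Z

  affine-two-points : ∀ Z {x y a b} → a ≢ b → x +v a · y ∈ Z → x +v b · y ∈ Z → y ∈ Z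
  affine-two-points Z {x} {y} {a} {b} a≢b x+ay∈Z x+by∈Z =
    subst (_∈ Z) (sym (·-solve (difference-≢0 a≢b) (sym (affine-difference a b x y))))
      (closed-· Z _ _ (affine-∈ Z (- 1#) x+ay∈Z x+by∈Z))

  ∈⟨⟩⇒∈ : ∀ X {x y v} → x ∈ X → y ∈ X → v ∈⟨ x , y ⟩ → v ∈ X
  ∈⟨⟩⇒∈ X x∈X y∈X (a , b , refl) = ∈-lincomb X a b x∈X y∈X

  ∈-∉-Indep : ∀ Z {x y} → x ≢ 0v → x ∈ Z → y ∉ Z → Indep x y
  ∈-∉-Indep Z {x} {y} x≢0 x∈Z y∉Z = ¬SamePoint⇒Indep x≢0 y≢0 λ where
      (s , _ , refl) → ∈⇒¬∉ {Z} (closed-· Z s x x∈Z) y∉Z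
    where
    y≢0 : y ≢ 0v
    y≢0 refl = ∈⇒¬∉ {Z} (has-0 Z) y∉Z

  ∉-line : ∀ Z {x y p s w} → p ∈⟨ x , y ⟩ → s ∈⟨ x , y ⟩ → w ∈⟨ x , y ⟩ → Indep p w →
    p ∈ Z → s ∉ Z → w ∉ Z
  ∉-line Z p∈ s∈ w∈ Ipw p∈Z s∉Z =
    ¬∈⇒∉ {Z} λ w∈Z → ∈⇒¬∉ {Z} (∈⟨⟩⇒∈ Z p∈Z w∈Z (span-exchange Ipw p∈ w∈ s∈)) s∉Z

  module _ (col : Colouring) where

    open Colouring col

    green-scale : ∀ a v → a ≢ 0# → green (a · v) ≡ green v
    green-scale a v a≢0 with v ≟v 0v
    ... | yes refl = cong green (·-zero a)
    ... | no v≢0 = invariant a v a≢0 v≢0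

    green-SamePoint : ∀ {u v} → SamePoint u v → green v ≡ green u
    green-SamePoint (a , a≢0 , refl) = green-scale a _ a≢0

    colours-Indep : ∀ {u v} → u ≢ 0v → v ≢ 0v → green u ≢ green v → Indep u v
    colours-Indep u≢0 v≢0 colours≢ = ¬SamePoint⇒Indep u≢0 v≢0 λ same → colours≢ (sym (green-SamePoint same))

  record Pair (col : Colouring) (x y : V) (κ : Bool) : Set c where
    constructor pair
    open Colouring col
    field
      {p₁ p₂} : V
      p₁∈⟨⟩ : p₁ ∈⟨ x , y ⟩
      p₂∈⟨⟩ : p₂ ∈⟨ x , y ⟩
      indep : Indep p₁ p₂
      colour₁ : green p₁ ≡ κ
      colour₂ : green p₂ ≡ κ

  record MixedLine (col : Colouring) (X : Subspace) : Set c where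
    constructor mixedLine
    field
      {x y} : V
      x∈X : x ∈ X
      y∈X : y ∈ X
      indep : Indep x y
      green-pair : Pair col x y true
      red-pair : Pair col x y false

  oppositePairs⇒mixedLine : ∀ {col X x y} κ → x ∈ X → y ∈ X → Indep x y →
    Pair col x y κ → Pair col x y (not κ) → MixedLine col X
  oppositePairs⇒mixedLine true = mixedLine
  oppositePairs⇒mixedLine false x∈X y∈X I red green = mixedLine x∈X y∈X I green red

  MixedLine-⊆ : ∀ {col Y X} → Y ⊆ X → MixedLine col Y → MixedLine col X
  MixedLine-⊆ Y⊆X (mixedLine x∈Y y∈Y I green red) = mixedLine (Y⊆X x∈Y) (Y⊆X y∈Y) I green red

module FiniteField {c} (K : Field c) {q} (ord : HasOrder K q) where

  open FieldProperties K

  element : Fin q → F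
  element = Inverse.to ord

  index : F → Fin q
  index = Inverse.from ord

  element-index : ∀ a → element (index a) ≡ a
  element-index = Inverse.strictlyInverseˡ ord

  element-injective : ∀ {i j} → element i ≡ element j → i ≡ j
  element-injective {i} {j} ei≡ej = begin
    i                   ≡⟨ sym (Inverse.strictlyInverseʳ ord i) ⟩
    index (element i)   ≡⟨ cong index ei≡ej ⟩
    index (element j)   ≡⟨ Inverse.strictlyInverseʳ ord j ⟩
    j                   ∎
    where open ≡-Reasoning

  module _ (2<q : 2 < q) where

    private
      1<q : 1 < q
      1<q = ℕ.<-trans (ℕ.s≤s (ℕ.s≤s ℕ.z≤n)) 2<q
      0<q : 0 < q
      0<q = ℕ.<-trans (ℕ.s≤s ℕ.z≤n) 1<q

      e₀ e₁ e₂ : Fin q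
      e₀ = Fin.fromℕ< 0<q
      e₁ = Fin.fromℕ< 1<q
      e₂ = Fin.fromℕ< 2<q

      distinct : ∀ {m n} (m<q : m < q) (n<q : n < q) → m ≢ n →
        element (Fin.fromℕ< m<q) ≢ element (Fin.fromℕ< n<q)
      distinct {m} {n} m<q n<q m≢n same = m≢n (begin
        m                          ≡⟨ sym (Fin.toℕ-fromℕ< m<q) ⟩
        toℕ (Fin.fromℕ< m<q)       ≡⟨ cong toℕ (element-injective same) ⟩
        toℕ (Fin.fromℕ< n<q)       ≡⟨ Fin.toℕ-fromℕ< n<q ⟩
        n                          ∎)
        where open ≡-Reasoning

    two-others : ∀ t → ∃₂ λ u u′ → u ≢ u′ × u ≢ t × u′ ≢ t
    two-others t with element e₀ ≟ t | element e₁ ≟ t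
    ... | yes e₀≡t | _ = element e₁ , element e₂ , distinct 1<q 2<q (λ ()) ,
                          (λ e₁≡t → distinct 1<q 0<q (λ ()) (trans e₁≡t (sym e₀≡t))) ,
                          (λ e₂≡t → distinct 2<q 0<q (λ ()) (trans e₂≡t (sym e₀≡t)))
    ... | no e₀≢t | yes e₁≡t = element e₀ , element e₂ , distinct 0<q 2<q (λ ()) , e₀≢t ,
                               (λ e₂≡t → distinct 2<q 1<q (λ ()) (trans e₂≡t (sym e₁≡t)))
    ... | no e₀≢t | no e₁≢t = element e₀ , element e₁ , distinct 0<q 1<q (λ ()) , e₀≢t , e₁≢t

  vectorAt : ∀ n → Fin (q ^ n) → Vec F n
  vectorAt zero _ = []
  vectorAt (suc n) k = uncurry (λ i j → element i ∷ vectorAt n j) (Fin.remQuot (q ^ n) k)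

  indexOf : ∀ {n} → Vec F n → Fin (q ^ n)
  indexOf [] = Fin.zero
  indexOf (a ∷ v) = Fin.combine (index a) (indexOf v)

  vectorAt-indexOf : ∀ {n} (v : Vec F n) → vectorAt n (indexOf v) ≡ v
  vectorAt-indexOf [] = refl
  vectorAt-indexOf {suc n} (a ∷ v) = begin
    vectorAt (suc n) (Fin.combine (index a) (indexOf v))
      ≡⟨ cong (uncurry (λ i j → element i ∷ vectorAt n j)) (Fin.remQuot-combine (index a) (indexOf v)) ⟩
    element (index a) ∷ vectorAt n (indexOf v)
      ≡⟨ cong₂ _∷_ (element-index a) (vectorAt-indexOf v) ⟩
    a ∷ v ∎
    where open ≡-Reasoning

  ∃? : ∀ {p} {P : F → Set p} → (∀ a → Dec (P a)) → Dec (∃ P)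
  ∃? = any?-onto element (λ a → index a , element-index a)

  ∃v? : ∀ {p n} {P : Vec F n → Set p} → (∀ v → Dec (P v)) → Dec (∃ P)
  ∃v? = any?-onto (vectorAt _) (λ v → indexOf v , vectorAt-indexOf v)

module FiniteSubspaces {c} (K : Field c) {q} (ord : HasOrder K q) (r : ℕ) where

  open FieldProperties K
  open Vectors K
  open Independence K r
  open ColouredSubspaces K r
  open FiniteField K ord
  open Geometry K r using (V; Subspace; member; has-0; closed-+; closed-·)

  module DecidableSubspace {p} {P : V → Set p} (P? : ∀ v → Dec (P v)) (P-0 : P 0v)
    (P-+ : ∀ {u v} → P u → P v → P (u +v v)) (P-· : ∀ a {v} → P v → P (a · v)) where

    subspace : Subspace
    subspace = record
      { member = λ v → does (P? v)
      ; has-0 = dec-true (P? 0v) P-0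
      ; closed-+ = λ u v u∈ v∈ → dec-true (P? _) (P-+ (dec-true⁻ (P? u) u∈) (dec-true⁻ (P? v) v∈))
      ; closed-· = λ a v v∈ → dec-true (P? _) (P-· a (dec-true⁻ (P? v) v∈))
      }

    ∈⁺ : ∀ {v} → P v → v ∈ subspace
    ∈⁺ {v} = dec-true (P? v)

    ∈⁻ : ∀ {v} → v ∈ subspace → P v
    ∈⁻ {v} = dec-true⁻ (P? v)

    ∉⁺ : ∀ {v} → ¬ P v → v ∉ subspace
    ∉⁺ {v} = dec-false (P? v)

  private
    0v-+v : ∀ {u v : V} → u ≡ 0v → v ≡ 0v → u +v v ≡ 0v
    0v-+v refl refl = +v-identityʳ 0v

    0v-· : ∀ a {v : V} → v ≡ 0v → a · v ≡ 0v
    0v-· a refl = ·-zero a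

  module Zero = DecidableSubspace (_≟v 0v) refl 0v-+v 0v-·

  zeroSubspace : Subspace
  zeroSubspace = Zero.subspace

  module Full = DecidableSubspace {P = λ _ → ⊤} (λ _ → yes tt) tt (λ _ _ → tt) (λ _ _ → tt)

  fullSubspace : Subspace
  fullSubspace = Full.subspace

  module Intersection (X Y : Subspace) = DecidableSubspace {P = λ v → v ∈ X × v ∈ Y}
    (λ v → (member X v Bool.≟ true) ×-dec (member Y v Bool.≟ true))
    (has-0 X , has-0 Y)
    (λ (u∈X , u∈Y) (v∈X , v∈Y) → closed-+ X _ _ u∈X v∈X , closed-+ Y _ _ u∈Y v∈Y)
    (λ a (v∈X , v∈Y) → closed-· X a _ v∈X , closed-· Y a _ v∈Y)

  infixl 7 _∩_
  _∩_ : Subspace → Subspace → Subspace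
  X ∩ Y = Intersection.subspace X Y

  private
    lookup-+v : ∀ i {u v : V} → lookup u i ≡ 0# → lookup v i ≡ 0# → lookup (u +v v) i ≡ 0#
    lookup-+v i {u} {v} uᵢ≡0 vᵢ≡0 = begin
      lookup (u +v v) i         ≡⟨ lookup-zipWith _+_ i u v ⟩
      lookup u i + lookup v i   ≡⟨ cong₂ _+_ uᵢ≡0 vᵢ≡0 ⟩
      0# + 0#                   ≡⟨ +-identityʳ 0# ⟩
      0#                        ∎
      where open ≡-Reasoning

    lookup-· : ∀ i a {v : V} → lookup v i ≡ 0# → lookup (a · v) i ≡ 0#
    lookup-· i a {v} vᵢ≡0 = trans (lookup-map i (a *_) v) (trans (cong (a *_) vᵢ≡0) (zeroʳ a))

  module Hyperplane (i : Fin r) =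
    DecidableSubspace (λ v → lookup v i ≟ 0#) (lookup-replicate i 0#)
      (λ {u} {v} → lookup-+v i {u} {v}) (λ a {v} → lookup-· i a {v})

  hyperplane : Fin r → Subspace
  hyperplane = Hyperplane.subspace

  module Join (Z : Subspace) (p : V) = DecidableSubspace {P = λ v → ∃ λ t → v +v t · p ∈ Z}
    (λ v → ∃? (λ t → member Z (v +v t · p) Bool.≟ true))
    (0# , subst (_∈ Z) (sym (affine-0 0v p)) (has-0 Z))
    (λ (s , u+sp∈Z) (t , v+tp∈Z) → s + t , subst (_∈ Z) (affine-+v s t _ _ p) (closed-+ Z _ _ u+sp∈Z v+tp∈Z))
    (λ a (t , v+tp∈Z) → a * t , subst (_∈ Z) (·-affine a t _ p) (closed-· Z a _ v+tp∈Z))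

  infixl 6 _∨_
  _∨_ : Subspace → V → Subspace
  Z ∨ p = Join.subspace Z p

  module Span (x y : V) = DecidableSubspace {P = _∈⟨ x , y ⟩}
    (λ v → ∃? (λ a → ∃? (λ b → v ≟v a · x +v b · y)))
    (0# , 0# , sym (lincomb-0-0 x y))
    (λ (a , b , u≡) (a′ , b′ , v≡) →
       a + a′ , b + b′ , trans (cong₂ _+v_ u≡ v≡) (lincomb-+v a b a′ b′ x y))
    (λ s (a , b , v≡) → s * a , s * b , trans (cong (s ·_) v≡) (·-lincomb s a b x y))

  ⟨_,_⟩ : V → V → Subspace
  ⟨ x , y ⟩ = Span.subspace x y

  infix 4 _⊂_
  _⊂_ : Subspace → Subspace → Set c
  Y ⊂ X = Y ⊆ X × ∃ λ w → w ∈ X × w ∉ Y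

  zero⊂ : ∀ {X w} → w ∈ X → w ≢ 0v → zeroSubspace ⊂ X
  zero⊂ {X} w∈X w≢0 =
    (λ {v} v∈0 → subst (_∈ X) (sym (Zero.∈⁻ {v} v∈0)) (has-0 X)) , _ , w∈X , Zero.∉⁺ w≢0

  avoid-two : ∀ {A B X} → A ⊂ X → B ⊂ X → ∃ λ x → x ∈ X × x ∉ A × x ∉ B
  avoid-two {A} {B} {X} (_ , a , a∈X , a∉A) (_ , b , b∈X , b∉B) with member B a in a∈?B | member A b in b∈?A
  ... | false | _ = a , a∈X , a∉A , a∈?B
  ... | true | false = b , b∈X , b∈?A , b∉B
  ... | true | true = a +v b , closed-+ X _ _ a∈X b∈X ,
    subst (_∉ A) (cong (a +v_) (·-identity b)) (affine-∉ A 1# a∉A b∈?A) ,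
    subst (_∉ B) (trans (cong (b +v_) (·-identity a)) (+v-comm b a)) (affine-∉ B 1# b∉B a∈?B)

  pointsOf : Subspace → Subset (q ^ r)
  pointsOf X = tabulate (λ k → member X (vectorAt r k))

  private
    ∈-pointsOf : ∀ {X k} → k ∈ₛ pointsOf X → vectorAt r k ∈ X
    ∈-pointsOf {X} {k} k∈ = trans (sym (lookup∘tabulate _ k)) ([]=⇒lookup k∈)

    ∈-pointsOf⁺ : ∀ {X k} → vectorAt r k ∈ X → k ∈ₛ pointsOf X
    ∈-pointsOf⁺ {X} {k} v∈X = lookup⇒[]= k _ (trans (lookup∘tabulate _ k) v∈X)

    pointsOf-⊂ : ∀ {Y X} → Y ⊂ X → pointsOf Y ⊂ₛ pointsOf X
    pointsOf-⊂ {Y} {X} (Y⊆X , w , w∈X , w∉Y) =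
      (λ k∈Y → ∈-pointsOf⁺ {X} (Y⊆X (∈-pointsOf {Y} k∈Y))) ,
      indexOf w , ∈-pointsOf⁺ {X} w′∈X , λ k∈Y → true≢false (trans (sym (∈-pointsOf {Y} k∈Y)) w′∉Y)
      where
      w′∈X = subst (_∈ X) (sym (vectorAt-indexOf w)) w∈X
      w′∉Y = subst (_∉ Y) (sym (vectorAt-indexOf w)) w∉Y

  ⊂-wellFounded : WellFounded _⊂_
  ⊂-wellFounded =
    Subrelation.wellFounded {_<₂_ = _<_ on size} (λ {Y} {X} → smaller {Y} {X}) (On.wellFounded size <-wellFounded)
    where
    size : Subspace → ℕ
    size X = ∣ pointsOf X ∣
    smaller : ∀ {Y X} → Y ⊂ X → size Y < size X
    smaller {Y} {X} Y⊂X = p⊂q⇒∣p∣<∣q∣ (pointsOf-⊂ {Y} {X} Y⊂X)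

module LinePoints {c} (K : Field c) {q} (ord : HasOrder K q) (r : ℕ) where

  open FieldProperties K
  open Vectors K
  open Independence K r
  open FiniteField K ord
  open Geometry K r using (V; SamePoint)
  open ≡-Reasoning

  coefficients : Fin (suc q) → F × F
  coefficients Fin.zero = 0# , 1#
  coefficients (Fin.suc j) = 1# , element j

  point : V → V → Fin (suc q) → V
  point x y j = proj₁ (coefficients j) · x +v proj₂ (coefficients j) · y

  point-∈⟨⟩ : ∀ x y j → point x y j ∈⟨ x , y ⟩
  point-∈⟨⟩ x y j = _ , _ , refl

  point-≢0 : ∀ {x y} → Indep x y → ∀ j → point x y j ≢ 0v
  point-≢0 I Fin.zero p≡0 = 1≢0 (proj₂ (I 0# 1# p≡0))
  point-≢0 I (Fin.suc j) p≡0 = 1≢0 (proj₁ (I 1# (element j) p≡0))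

  point-injective : ∀ {x y} → Indep x y → ∀ {j j′} → SamePoint (point x y j) (point x y j′) → j ≡ j′
  point-injective {x} {y} I {j} {j′} (s , s≢0 , p′≡sp) =
    uncurry (scaled j j′) (Indep-coefficients I (trans p′≡sp (·-lincomb s _ _ x y)))
    where
    scaled : ∀ j j′ → proj₁ (coefficients j′) ≡ s * proj₁ (coefficients j) →
             proj₂ (coefficients j′) ≡ s * proj₂ (coefficients j) → j ≡ j′
    scaled Fin.zero Fin.zero _ _ = refl
    scaled Fin.zero (Fin.suc j′) 1≡s0 _ = ⊥-elim (1≢0 (trans 1≡s0 (zeroʳ s)))
    scaled (Fin.suc j) Fin.zero 0≡s1 _ = ⊥-elim (s≢0 (sym (trans 0≡s1 (*-identityʳ s))))
    scaled (Fin.suc j) (Fin.suc j′) 1≡s1 e′≡se = cong Fin.suc (element-injective (sym (begin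
      element j′       ≡⟨ e′≡se ⟩
      s * element j    ≡⟨ cong (_* element j) (sym (trans 1≡s1 (*-identityʳ s))) ⟩
      1# * element j   ≡⟨ *-identityˡ _ ⟩
      element j        ∎)))

  point-Indep : ∀ {x y} → Indep x y → ∀ {j j′} → j ≢ j′ → Indep (point x y j) (point x y j′)
  point-Indep I {j} {j′} j≢j′ =
    ¬SamePoint⇒Indep (point-≢0 I j) (point-≢0 I j′) (λ same → j≢j′ (point-injective I same))

  point-onto : ∀ {x y v} → v ∈⟨ x , y ⟩ → v ≢ 0v → ∃ λ j → SamePoint (point x y j) v
  point-onto {x} {y} (a , b , refl) v≢0 with a ≟ 0#
  ... | yes refl = Fin.zero , b , b≢0 , (begin
    0# · x +v b · y                ≡⟨ cong₂ (λ s t → s · x +v t · y) (sym (zeroʳ b)) (sym (*-identityʳ b)) ⟩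
    (b * 0#) · x +v (b * 1#) · y   ≡⟨ sym (·-lincomb b 0# 1# x y) ⟩
    b · point x y Fin.zero         ∎)
    where
    b≢0 : b ≢ 0#
    b≢0 refl = v≢0 (lincomb-0-0 x y)
  ... | no a≢0 = Fin.suc (index (inv a a≢0 * b)) , a , a≢0 , (begin
    a · x +v b · y
      ≡⟨ cong₂ (λ s t → s · x +v t · y) (sym (*-identityʳ a)) (sym a[a⁻¹b]≡b) ⟩
    (a * 1#) · x +v (a * element (index (inv a a≢0 * b))) · y  ≡⟨ sym (·-lincomb a _ _ x y) ⟩
    a · point x y (Fin.suc (index (inv a a≢0 * b)))          ∎)
    where
    a[a⁻¹b]≡b : a * element (index (inv a a≢0 * b)) ≡ b
    a[a⁻¹b]≡b = begin
      a * element (index (inv a a≢0 * b))  ≡⟨ cong (a *_) (element-index _) ⟩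
      a * (inv a a≢0 * b)                   ≡⟨ sym (*-assoc a _ b) ⟩
      a * inv a a≢0 * b                     ≡⟨ cong (_* b) (*-inverseʳ a a≢0) ⟩
      1# * b                                ≡⟨ *-identityˡ b ⟩
      b                                     ∎

module InducedU2 {c} (K : Field c) {q} (ord : HasOrder K q) (r : ℕ) where

  open Vectors K
  open Independence K r
  open ColouredSubspaces K r
  open FiniteSubspaces K ord r
  open LinePoints K ord r
  open Geometry K r using (V; Colouring; Subspace; HasInducedU2; SamePoint; Dependent3)

  module _ (col : Colouring) where

    open Colouring col

    greenOn : V → V → Subset (suc q)
    greenOn x y = tabulate (λ j → green (point x y j))

    ∈-greenOn⁻ : ∀ {x y j} → j ∈ₛ greenOn x y → green (point x y j) ≡ true
    ∈-greenOn⁻ {x} {y} {j} j∈ = trans (sym (lookup∘tabulate (λ j → green (point x y j)) j)) ([]=⇒lookup j∈)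

    ∈-greenOn⁺ : ∀ {x y j} → green (point x y j) ≡ true → j ∈ₛ greenOn x y
    ∈-greenOn⁺ {x} {y} {j} green-j = lookup⇒[]= j _ (trans (lookup∘tabulate (λ j → green (point x y j)) j) green-j)

    ∈-redOn⁺ : ∀ {x y j} → green (point x y j) ≡ false → j ∈ₛ ∁ (greenOn x y)
    ∈-redOn⁺ red-j = x∉p⇒x∈∁p λ j∈ → true≢false (trans (sym (∈-greenOn⁻ j∈)) red-j)

    ∈-redOn⁻ : ∀ {x y j} → j ∈ₛ ∁ (greenOn x y) → green (point x y j) ≡ false
    ∈-redOn⁻ {x} {y} {j} j∈∁ with green (point x y j) in green-j
    ... | true = ⊥-elim (x∈∁p⇒x∉p j∈∁ (∈-greenOn⁺ green-j))
    ... | false = refl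

    pair-points : ∀ {x y κ} → Pair col x y κ →
      ∃₂ λ j₁ j₂ → j₁ ≢ j₂ × green (point x y j₁) ≡ κ × green (point x y j₂) ≡ κ
    pair-points {x} {y} (pair p₁∈ p₂∈ I colour₁ colour₂)
      with j₁ , same₁ ← point-onto p₁∈ (Indep-nonzeroˡ I) | j₂ , same₂ ← point-onto p₂∈ (Indep-nonzeroʳ I) =
      j₁ , j₂ , distinct , trans (sym (green-SamePoint col same₁)) colour₁ , trans (sym (green-SamePoint col same₂)) colour₂
      where
      distinct : j₁ ≢ j₂
      distinct refl = Indep⇒¬SamePoint I (SamePoint-trans same₁ same₂)

    private
      two≤⇒≤q∸1 : ∀ {a b} → a ℕ.+ b ≡ suc q → 2 ≤ b → a ≤ q ∸ 1
      two≤⇒≤q∸1 {a} {b} a+b≡1+q 2≤b = ℕ.m+n≤o⇒m≤o∸n a (ℕ.≤-pred (begin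
        suc (a ℕ.+ 1)  ≡⟨ sym (ℕ.+-suc a 1) ⟩
        a ℕ.+ 2        ≤⟨ ℕ.+-monoʳ-≤ a 2≤b ⟩
        a ℕ.+ b        ≡⟨ a+b≡1+q ⟩
        suc q        ∎))
        where open ℕ.≤-Reasoning

      ≤q∸1⇒two≤ : ∀ {a b} → a ℕ.+ b ≡ suc q → 1 ≤ q → a ≤ q ∸ 1 → 2 ≤ b
      ≤q∸1⇒two≤ {a} {b} a+b≡1+q 1≤q a≤q∸1 = ℕ.+-cancelˡ-≤ a 2 b (begin
        a ℕ.+ 2        ≡⟨ ℕ.+-suc a 1 ⟩
        suc (a ℕ.+ 1)  ≤⟨ ℕ.s≤s (ℕ.m≤o∸n⇒m+n≤o a 1≤q a≤q∸1) ⟩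
        suc q          ≡⟨ sym a+b≡1+q ⟩
        a ℕ.+ b        ∎)
        where open ℕ.≤-Reasoning

    mixedLine⇒inducedU2 : ∀ {X} → MixedLine col X → ∃[ m ] (2 ≤ m × m ≤ q ∸ 1 × HasInducedU2 col m)
    mixedLine⇒inducedU2 (mixedLine {x} {y} _ _ I green-pair red-pair)
      with g₁ , g₂ , g₁≢g₂ , green-g₁ , green-g₂ ← pair-points green-pair
         | r₁ , r₂ , r₁≢r₂ , red-r₁ , red-r₂ ← pair-points red-pair =
      ∣ p ∣ , two≤∣ p ∣ (∈-greenOn⁺ green-g₁) (∈-greenOn⁺ green-g₂) g₁≢g₂ ,
      two≤⇒≤q∸1 (∣p∣+∣∁p∣ p) (two≤∣ ∁ p ∣ (∈-redOn⁺ red-r₁) (∈-redOn⁺ red-r₂) r₁≢r₂) ,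
      ⟨ x , y ⟩ , e ,
      (λ i → point-≢0 I (σ i) , ∈-greenOn⁻ (enumerate-∈ p i) , Span.∈⁺ x y (point-∈⟨⟩ x y (σ i))) ,
      distinct , covers , dependent
      where
      p = greenOn x y
      σ = enumerate p
      e : Fin ∣ p ∣ → V
      e i = point x y (σ i)
      e-Indep : ∀ {i j} → i ≢ j → Indep (e i) (e j)
      e-Indep {i} {j} i≢j = point-Indep I {σ i} {σ j} (λ same → i≢j (enumerate-injective p same))
      distinct : ∀ i j → i ≢ j → ¬ SamePoint (e i) (e j)
      distinct i j i≢j = Indep⇒¬SamePoint (e-Indep i≢j)
      covers : ∀ v → v ≢ 0v → green v ≡ true → v ∈ ⟨ x , y ⟩ → ∃[ i ] SamePoint (e i) v
      covers v v≢0 green-v v∈ with j , same ← point-onto (Span.∈⁻ x y v∈) v≢0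
        with i , refl ← enumerate-onto p {j} (∈-greenOn⁺ (trans (sym (green-SamePoint col same)) green-v)) = i , same
      dependent : ∀ i j l → i ≢ j → j ≢ l → i ≢ l → Dependent3 (e i) (e j) (e l)
      dependent i j l i≢j _ _ =
        span-dependent (span-exchange (e-Indep i≢j)
          (point-∈⟨⟩ x y (σ i)) (point-∈⟨⟩ x y (σ j)) (point-∈⟨⟩ x y (σ l)))

    inducedU2⇒mixedLine : ∀ {m} → 2 ≤ m → m ≤ q ∸ 1 → HasInducedU2 col m → Σ Subspace (MixedLine col)
    inducedU2⇒mixedLine {m} 2≤m m≤q∸1 (F , e , points , distinct , covers , _) =
      F , mixedLine x∈F y∈F I (pair (∈⟨⟩-left x y) (∈⟨⟩-right x y) I green-x green-y) red-pair
      where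
      e₀ e₁ : Fin m
      e₀ = proj₁ (2≤⇒distinct 2≤m)
      e₁ = proj₁ (proj₂ (2≤⇒distinct 2≤m))
      x = e e₀
      y = e e₁
      x≢0 = proj₁ (points e₀)
      green-x = proj₁ (proj₂ (points e₀))
      x∈F = proj₂ (proj₂ (points e₀))
      y≢0 = proj₁ (points e₁)
      green-y = proj₁ (proj₂ (points e₁))
      y∈F = proj₂ (proj₂ (points e₁))
      I : Indep x y
      I = ¬SamePoint⇒Indep x≢0 y≢0 (distinct e₀ e₁ (proj₂ (proj₂ (2≤⇒distinct 2≤m))))
      p = greenOn x y
      σ = enumerate p
      covered : ∀ i → ∃ λ k → SamePoint (e k) (point x y (σ i))
      covered i =
        covers _ (point-≢0 I (σ i)) (∈-greenOn⁻ (enumerate-∈ p i)) (∈⟨⟩⇒∈ F x∈F y∈F (point-∈⟨⟩ x y (σ i)))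
      index-in-e : Fin ∣ p ∣ → Fin m
      index-in-e i = proj₁ (covered i)
      index-in-e-injective : ∀ {i i′} → index-in-e i ≡ index-in-e i′ → i ≡ i′
      index-in-e-injective {i} {i′} same-index = enumerate-injective p (point-injective I {σ i} {σ i′} (SamePoint-trans
        (subst (λ k → SamePoint (e k) (point x y (σ i))) same-index (proj₂ (covered i))) (proj₂ (covered i′))))
      1≤q : 1 ≤ q
      1≤q = ℕ.≤-trans (ℕ.s≤s ℕ.z≤n) (ℕ.≤-trans 2≤m (ℕ.≤-trans m≤q∸1 (ℕ.m∸n≤m q 1)))
      two-red : 2 ≤ ∣ ∁ p ∣
      two-red = ≤q∸1⇒two≤ (∣p∣+∣∁p∣ p) 1≤q (ℕ.≤-trans (Fin.injective⇒≤ index-in-e-injective) m≤q∸1)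
      red-pair : Pair col x y false
      red-pair = pair (point-∈⟨⟩ x y (enumerate (∁ p) i)) (point-∈⟨⟩ x y (enumerate (∁ p) i′))
                      (point-Indep I (λ same → i≢i′ (enumerate-injective (∁ p) same)))
                      (∈-redOn⁻ (enumerate-∈ (∁ p) i)) (∈-redOn⁻ (enumerate-∈ (∁ p) i′))
        where
        i = proj₁ (2≤⇒distinct two-red)
        i′ = proj₁ (proj₂ (2≤⇒distinct two-red))
        i≢i′ = proj₂ (proj₂ (2≤⇒distinct two-red))

module Targets {c} (K : Field c) (r : ℕ) where

  open Vectors K
  open Independence K r
  open ColouredSubspaces K r
  open Geometry K r using (Colouring; Subspace; member; IsTarget)

  chain-monotone : ∀ {k} (W : Fin (suc k) → Subspace) → (∀ i → W (Fin.inject₁ i) ⊆ W (Fin.suc i)) →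
    ∀ {i j} → toℕ i ≤ toℕ j → W i ⊆ W j
  chain-monotone {k} W step {i} {j} i≤j = climb (toℕ j ∸ toℕ i) j (sym (ℕ.m+[n∸m]≡n i≤j))
    where
    climb : ∀ d j → toℕ j ≡ toℕ i ℕ.+ d → W i ⊆ W j
    climb zero j j≡i = subst (λ j → W i ⊆ W j) i≡j (λ v∈ → v∈)
      where
      i≡j = Fin.toℕ-injective {i = i} {j = j} (trans (sym (ℕ.+-identityʳ (toℕ i))) (sym j≡i))
    climb (suc d) Fin.zero 0≡i+1+d = ⊥-elim (ℕ.0≢1+n (trans 0≡i+1+d (ℕ.+-suc (toℕ i) d)))
    climb (suc d) (Fin.suc j) 1+j≡i+1+d =
      step j ∘ climb d (Fin.inject₁ j)
        (trans (Fin.toℕ-inject₁ j) (ℕ.suc-injective (trans 1+j≡i+1+d (ℕ.+-suc (toℕ i) d))))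

  module _ {col : Colouring} (target : IsTarget col) where

    open Colouring col

    private
      W = proj₁ (proj₂ target)
      step = proj₁ (proj₂ (proj₂ (proj₂ (proj₂ target))))
      layers = proj₂ (proj₂ (proj₂ (proj₂ (proj₂ target))))

      monotone : ∀ {i j} → toℕ i ≤ toℕ j → W i ⊆ W j
      monotone = chain-monotone W (λ i {v} → step i v)

    profile-colour : ∀ {u v} → u ≢ 0v → v ≢ 0v → (∀ j → member (W j) u ≡ member (W j) v) → green u ≡ green v
    profile-colour {u} {v} u≢0 v≢0 same = ⇔→≡ (mk⇔
      (λ green-u → proj₂ (layers v v≢0) (transport (proj₁ (layers u u≢0) green-u)))
      (λ green-v → proj₂ (layers u u≢0) (transport′ (proj₁ (layers v v≢0) green-v))))
      where
      transport = λ (i , even , u∉ , u∈) → i , even , trans (sym (same _)) u∉ , trans (sym (same _)) u∈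
      transport′ = λ (i , even , v∉ , v∈) → i , even , trans (same _) v∉ , trans (same _) v∈

    separated-profile : ∀ {x y p s u v} → p ∈⟨ x , y ⟩ → s ∈⟨ x , y ⟩ → u ∈⟨ x , y ⟩ → v ∈⟨ x , y ⟩ →
      Indep p u → Indep p v → ∀ j → p ∈ W j → s ∉ W j → ∀ j′ → member (W j′) u ≡ member (W j′) v
    separated-profile {u = u} {v} p∈ s∈ u∈ v∈ Ipu Ipv j p∈Wj s∉Wj j′ =
      [ below , above ]′ (ℕ.≤-total (toℕ j′) (toℕ j))
      where
      u∉Wj : u ∉ W j
      u∉Wj = ∉-line (W j) p∈ s∈ u∈ Ipu p∈Wj s∉Wj
      v∉Wj : v ∉ W j
      v∉Wj = ∉-line (W j) p∈ s∈ v∈ Ipv p∈Wj s∉Wj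
      below : toℕ j′ ≤ toℕ j → member (W j′) u ≡ member (W j′) v
      below j′≤j =
        trans (∉-⊆ {W j′} {W j} {u} (monotone j′≤j) u∉Wj) (sym (∉-⊆ {W j′} {W j} {v} (monotone j′≤j) v∉Wj))
      above : toℕ j ≤ toℕ j′ → member (W j′) u ≡ member (W j′) v
      above j≤j′ = ⇔→≡ (mk⇔ (λ u∈Wj′ → ∈⟨⟩⇒∈ (W j′) p∈Wj′ u∈Wj′ (span-exchange Ipu p∈ u∈ v∈))
                            (λ v∈Wj′ → ∈⟨⟩⇒∈ (W j′) p∈Wj′ v∈Wj′ (span-exchange Ipv p∈ v∈ u∈)))
        where
        p∈Wj′ = monotone j≤j′ p∈Wj

    private
      clash : ∀ {u v} → u ≢ 0v → v ≢ 0v → green u ≡ true → green v ≡ false →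
        ¬ (∀ j → member (W j) u ≡ member (W j) v)
      clash u≢0 v≢0 green-u red-v same = true≢false (trans (sym green-u) (trans (profile-colour u≢0 v≢0 same) red-v))

      colours-differ : ∀ {u v} → green u ≡ true → green v ≡ false → green u ≢ green v
      colours-differ green-u red-v same = true≢false (trans (sym green-u) (trans same red-v))

    -- Some flat W j contains exactly one of g₁ and r₁, so it meets the line only in that point; then
    -- g₂ and r₂ lie in the same flats and must have the same colour.
    target⇒noMixedLine : ∀ {X} → ¬ MixedLine col X
    target⇒noMixedLine
      (mixedLine _ _ _ (pair {g₁} {g₂} g₁∈ g₂∈ Ig green₁ green₂) (pair {r₁} {r₂} r₁∈ r₂∈ Ir red₁ red₂))
      with Fin.any? (λ j → ¬? (member (W j) g₁ Bool.≟ member (W j) r₁))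
    ... | no never = clash (Indep-nonzeroˡ Ig) (Indep-nonzeroˡ Ir) green₁ red₁
          λ j → decidable-stable (member (W j) g₁ Bool.≟ member (W j) r₁) (λ ne → never (j , ne))
    ... | yes (j , differ) with member (W j) g₁ in g₁∈Wj | member (W j) r₁ in r₁∈Wj
    ...   | true | true = differ refl
    ...   | false | false = differ refl
    ...   | true | false = clash (Indep-nonzeroʳ Ig) (Indep-nonzeroʳ Ir) green₂ red₂
            (separated-profile g₁∈ r₁∈ g₂∈ r₂∈ Ig
              (colours-Indep col (Indep-nonzeroˡ Ig) (Indep-nonzeroʳ Ir) (colours-differ green₁ red₂)) j g₁∈Wj r₁∈Wj)
    ...   | false | true = clash (Indep-nonzeroʳ Ig) (Indep-nonzeroʳ Ir) green₂ red₂
            (separated-profile r₁∈ g₁∈ g₂∈ r₂∈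
              (colours-Indep col (Indep-nonzeroˡ Ir) (Indep-nonzeroʳ Ig) (colours-differ green₂ red₁ ∘ sym)) Ir j r₁∈Wj g₁∈Wj)

module Projection {c} (K : Field c) {q} (ord : HasOrder K q) (r : ℕ) where

  open FieldProperties K
  open Vectors K
  open Independence K r
  open ColouredSubspaces K r
  open FiniteField K ord
  open FiniteSubspaces K ord r
  open Geometry K r using (V; Colouring; has-0; closed-+; closed-·)
  open ≡-Reasoning

  module _ (col : Colouring) (p : V) where

    open Colouring col

    sees? : ∀ h → Dec (∃ λ t → green (h +v t · p) ≡ green p)
    sees? h = ∃? (λ t → green (h +v t · p) Bool.≟ green p)

    private
      sees-scaled : ∀ a h → a ≢ 0# → ∃ (λ t → green (h +v t · p) ≡ green p) →
        ∃ λ t → green (a · h +v t · p) ≡ green p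
      sees-scaled a h a≢0 (t , same) = a * t , (begin
        green (a · h +v (a * t) · p)  ≡⟨ cong green (sym (·-affine a t h p)) ⟩
        green (a · (h +v t · p))      ≡⟨ green-scale col a _ a≢0 ⟩
        green (h +v t · p)            ≡⟨ same ⟩
        green p                       ∎)

      a⁻¹[ah]≡h : ∀ a (a≢0 : a ≢ 0#) (h : V) → inv a a≢0 · (a · h) ≡ h
      a⁻¹[ah]≡h a a≢0 h = trans (·-assoc _ a h) (trans (cong (_· h) (*-inverseˡ a a≢0)) (·-identity h))

    -- A line through p is represented by any of its points h other than p; it is green when it
    -- carries a point other than p of the colour of p.
    projection : Colouring
    projection = record
      { green = λ h → does (sees? h)
      ; invariant = λ a h a≢0 _ → ⇔→≡ (mk⇔
          (λ sees-ah → dec-true (sees? h) (subst (λ v → ∃ λ t → green (v +v t · p) ≡ green p) (a⁻¹[ah]≡h a a≢0 h)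
             (sees-scaled (inv a a≢0) (a · h) (inv-≢0 a a≢0) (dec-true⁻ (sees? (a · h)) sees-ah))))
          (λ sees-h → dec-true (sees? (a · h)) (sees-scaled a h a≢0 (dec-true⁻ (sees? h) sees-h))))
      }

  module _ {p : V} {i : Fin r} (pᵢ≢0 : lookup p i ≢ 0#) where

    offset-unique : ∀ {h t} → h ∈ hyperplane i → h +v t · p ∈ hyperplane i → t ≡ 0#
    offset-unique {h} {t} h∈ h+tp∈ = *-cancelˡ pᵢ≢0 (begin
      lookup p i * t              ≡⟨ solve 2 (λ pᵢ t → pᵢ :* t := :0 :+ t :* pᵢ) refl (lookup p i) t ⟩
      0# + t * lookup p i         ≡⟨ cong (_+ t * lookup p i) (sym (Hyperplane.∈⁻ i {h} h∈)) ⟩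
      lookup h i + t * lookup p i ≡⟨ sym (lookup-affine t h p i) ⟩
      lookup (h +v t · p) i       ≡⟨ Hyperplane.∈⁻ i {h +v t · p} h+tp∈ ⟩
      0#                          ∎)

    component : ∀ v → ∃ λ s → v +v s · p ∈ hyperplane i
    component v = - (lookup v i * inv (lookup p i) pᵢ≢0) , Hyperplane.∈⁺ i {v +v s · p} (begin
      lookup (v +v s · p) i                       ≡⟨ lookup-affine s v p i ⟩
      lookup v i + s * lookup p i                 ≡⟨ solve 3 (λ vᵢ pᵢ p⁻¹ → vᵢ :+ (:- (vᵢ :* p⁻¹)) :* pᵢ
                                                       := vᵢ :+ :- (vᵢ :* (p⁻¹ :* pᵢ))) refl (lookup v i) (lookup p i) p⁻¹ ⟩
      lookup v i + - (lookup v i * (p⁻¹ * lookup p i))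
                                                  ≡⟨ cong (λ z → lookup v i + - (lookup v i * z)) (*-inverseˡ _ pᵢ≢0) ⟩
      lookup v i + - (lookup v i * 1#)            ≡⟨ solve 1 (λ vᵢ → vᵢ :+ :- (vᵢ :* :1) := :0) refl (lookup v i) ⟩
      0#                                          ∎)
      where
      p⁻¹ = inv (lookup p i) pᵢ≢0
      s = - (lookup v i * p⁻¹)

    lift-Indep : ∀ {k₁ k₂} t₁ t₂ → k₁ ∈ hyperplane i → k₂ ∈ hyperplane i → Indep k₁ k₂ →
      Indep (k₁ +v t₁ · p) (k₂ +v t₂ · p)
    lift-Indep {k₁} {k₂} t₁ t₂ k₁∈ k₂∈ I a b lifted≡0 = I a b (begin
      a · k₁ +v b · k₂                              ≡⟨ sym (affine-0 _ p) ⟩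
      (a · k₁ +v b · k₂) +v 0# · p                  ≡⟨ cong (λ t → (a · k₁ +v b · k₂) +v t · p) (sym offset≡0) ⟩
      (a · k₁ +v b · k₂) +v (a * t₁ + b * t₂) · p   ≡⟨ sym (lincomb-affine₂ a b t₁ t₂ k₁ k₂ p) ⟩
      a · (k₁ +v t₁ · p) +v b · (k₂ +v t₂ · p)      ≡⟨ lifted≡0 ⟩
      0v                                            ∎)
      where
      offset≡0 : a * t₁ + b * t₂ ≡ 0#
      offset≡0 = offset-unique {a · k₁ +v b · k₂} (∈-lincomb (hyperplane i) {k₁} {k₂} a b k₁∈ k₂∈)
        (subst (_∈ hyperplane i) (sym (trans (sym (lincomb-affine₂ a b t₁ t₂ k₁ k₂ p)) lifted≡0)) (has-0 (hyperplane i)))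

  -- The green pair lifts to two points of the colour of p; on the line of X through them, the
  -- points above the red pair have the other colour.
  projection-noMixedLine : ∀ {col X p i} → lookup p i ≢ 0# → p ∈ X → ¬ MixedLine col X →
    ¬ MixedLine (projection col p) (X ∩ hyperplane i)
  projection-noMixedLine {col} {X} {p} {i} pᵢ≢0 p∈X noMixed
    (mixedLine {x} {y} x∈H y∈H _ (pair {g₁} {g₂} g₁∈ g₂∈ Ig sees₁ sees₂)
                                 (pair {r₁} {r₂} r₁∈ r₂∈ Ir blind₁ blind₂)) =
    noMixed (oppositePairs⇒mixedLine (green p) x₁∈X x₂∈X I₁₂
      (pair (∈⟨⟩-left x₁ x₂) (∈⟨⟩-right x₁ x₂) I₁₂ (proj₂ lift₁) (proj₂ lift₂))
      (pair (_ , _ , refl) (_ , _ , refl) (subst₂ Indep (sym (ρ≡ r₁∈)) (sym (ρ≡ r₂∈)) Iρ)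
            (red r₁∈ blind₁) (red r₂∈ blind₂)))
    where
    open Colouring col
    in-H : ∀ {v} → v ∈⟨ x , y ⟩ → v ∈ X × v ∈ hyperplane i
    in-H {v} v∈ = Intersection.∈⁻ X (hyperplane i) {v} (∈⟨⟩⇒∈ (X ∩ hyperplane i) x∈H y∈H v∈)
    lift₁ = dec-true⁻ (sees? col p g₁) sees₁
    lift₂ = dec-true⁻ (sees? col p g₂) sees₂
    x₁ = g₁ +v proj₁ lift₁ · p
    x₂ = g₂ +v proj₁ lift₂ · p
    x₁∈X = closed-+ X _ _ (proj₁ (in-H g₁∈)) (closed-· X _ p p∈X)
    x₂∈X = closed-+ X _ _ (proj₁ (in-H g₂∈)) (closed-· X _ p p∈X)
    I₁₂ : Indep x₁ x₂
    I₁₂ = lift-Indep pᵢ≢0 _ _ (proj₂ (in-H g₁∈)) (proj₂ (in-H g₂∈)) Ig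
    coordinates : ∀ {v} → v ∈⟨ x , y ⟩ → v ∈⟨ g₁ , g₂ ⟩
    coordinates = span-exchange Ig g₁∈ g₂∈
    offset : ∀ {v} → v ∈⟨ x , y ⟩ → F
    offset v∈ = let (α , β , _) = coordinates v∈ in α * proj₁ lift₁ + β * proj₁ lift₂
    ρ≡ : ∀ {v} (v∈ : v ∈⟨ x , y ⟩) →
      proj₁ (coordinates v∈) · x₁ +v proj₁ (proj₂ (coordinates v∈)) · x₂ ≡ v +v offset v∈ · p
    ρ≡ v∈ with α , β , refl ← coordinates v∈ = lincomb-affine₂ α β _ _ g₁ g₂ p
    red : ∀ {v} (v∈ : v ∈⟨ x , y ⟩) → does (sees? col p v) ≡ false →
      green (proj₁ (coordinates v∈) · x₁ +v proj₁ (proj₂ (coordinates v∈)) · x₂) ≡ not (green p)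
    red v∈ blind = trans (cong green (ρ≡ v∈)) (¬-not λ same → dec-false⁻ (sees? col p _) blind (offset v∈ , same))
    Iρ = lift-Indep pᵢ≢0 (offset r₁∈) (offset r₂∈) (proj₂ (in-H r₁∈)) (proj₂ (in-H r₂∈)) Ir

module Confinement {c} (K : Field c) {q} (ord : HasOrder K q) (r : ℕ) where

  open FieldProperties K
  open Vectors K
  open Independence K r
  open ColouredSubspaces K r
  open FiniteField K ord
  open FiniteSubspaces K ord r
  open Projection K ord r
  open Geometry K r using (V; Colouring; Subspace; member; has-0; closed-+; closed-·)

  NonZero : Subspace → Set c
  NonZero X = ∃ λ w → w ∈ X × w ≢ 0v

  record Confined (col : Colouring) (X : Subspace) : Set c where
    constructor confined
    open Colouring col
    field
      Z : Subspace
      Z⊂X : Z ⊂ X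
      colour : Bool
      class⊆Z : ∀ {v} → v ∈ X → v ≢ 0v → green v ≡ colour → v ∈ Z

  record Repeats (col : Colouring) (X : Subspace) (p : V) : Set c where
    constructor repeats
    open Colouring col
    field
      Z : Subspace
      Z⊂X : Z ⊂ X
      p∈Z : p ∈ Z
      again : ∀ {x} → x ∈ X → x ∉ Z → ∃ λ t → green (x +v t · p) ≡ green p

  module AtPoint {col : Colouring} {X : Subspace} {p : V} (p∈X : p ∈ X) (p≢0 : p ≢ 0v) where

    open Colouring col

    i = proj₁ (nonzero-coordinate p p≢0)
    pᵢ≢0 = proj₂ (nonzero-coordinate p p≢0)

    H : Subspace
    H = X ∩ hyperplane i

    H⊆X : H ⊆ X
    H⊆X {v} v∈H = proj₁ (Intersection.∈⁻ X (hyperplane i) {v} v∈H)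

    H⊂X : H ⊂ X
    H⊂X = H⊆X , p , p∈X ,
      Intersection.∉⁺ X (hyperplane i) (λ (_ , p∈hyperplane) → pᵢ≢0 (Hyperplane.∈⁻ i {p} p∈hyperplane))

    to-H : ∀ {v} → v ∈ X → ∃ λ s → v +v s · p ∈ H
    to-H {v} v∈X = let (s , v′∈hyperplane) = component pᵢ≢0 v in
      s , Intersection.∈⁺ X (hyperplane i) (closed-+ X _ _ v∈X (closed-· X s p p∈X) , v′∈hyperplane)

    H-nonzero : ∀ {o} → o ∈ X → o ≢ 0v → green o ≢ green p → NonZero H
    H-nonzero {o} o∈X o≢0 o≁p = o +v s · p , o′∈H , o′≢0
      where
      s = proj₁ (to-H o∈X)
      o′∈H = proj₂ (to-H o∈X)
      o≡-sp : o +v s · p ≡ 0v → o ≡ (- s) · p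
      o≡-sp o′≡0 = trans (sym (affine-cancel s o p)) (trans (cong (_+v (- s) · p) o′≡0) (+v-identityˡ _))
      o′≢0 : o +v s · p ≢ 0v
      o′≢0 o′≡0 with (- s) ≟ 0#
      ... | yes -s≡0 = o≢0 (trans (o≡-sp o′≡0) (trans (cong (_· p) -s≡0) (0· p)))
      ... | no -s≢0 = o≁p (trans (cong green (o≡-sp o′≡0)) (green-scale col (- s) p -s≢0))

    module Lifted (Z′ : Subspace) (Z′⊆H : Z′ ⊆ H) (w : V) (w∈H : w ∈ H) (w∉Z′ : w ∉ Z′) where

      Zp : Subspace
      Zp = X ∩ (Z′ ∨ p)

      in-Zp : ∀ {v} → v ∈ X → (∃ λ s → v +v s · p ∈ Z′) → v ∈ Zp
      in-Zp v∈X v+sp∈Z′ = Intersection.∈⁺ X (Z′ ∨ p) (v∈X , Join.∈⁺ Z′ p v+sp∈Z′)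

      w∉Zp : w ∉ Zp
      w∉Zp = Intersection.∉⁺ X (Z′ ∨ p) λ (_ , w∈join) →
        let (t , w+tp∈Z′) = Join.∈⁻ Z′ p {w} w∈join
            t≡0 = offset-unique {p} {i} pᵢ≢0 {w} {t} (proj₂ (Intersection.∈⁻ X (hyperplane i) {w} w∈H))
                    (proj₂ (Intersection.∈⁻ X (hyperplane i) {w +v t · p} (Z′⊆H w+tp∈Z′)))
        in ∈⇒¬∉ {Z′} (subst (_∈ Z′) (trans (cong (λ t → w +v t · p) t≡0) (affine-0 w p)) w+tp∈Z′) w∉Z′

      Zp⊂X : Zp ⊂ X
      Zp⊂X = (λ {v} v∈Zp → proj₁ (Intersection.∈⁻ X (Z′ ∨ p) {v} v∈Zp)) , w , H⊆X w∈H , w∉Zp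

      component-in-Z′ : ∀ {v} (v∈X : v ∈ X) →
        (v +v proj₁ (to-H v∈X) · p ≢ 0v → v +v proj₁ (to-H v∈X) · p ∈ Z′) → ∃ λ s → v +v s · p ∈ Z′
      component-in-Z′ {v} v∈X nonzero-case with v +v proj₁ (to-H v∈X) · p ≟v 0v
      ... | yes h≡0 = _ , subst (_∈ Z′) (sym h≡0) (has-0 Z′)
      ... | no h≢0 = _ , nonzero-case h≢0

    lift-confined : Confined (projection col p) H → Confined col X ⊎ Repeats col X p
    lift-confined (confined Z′ (Z′⊆H , w , w∈H , w∉Z′) true class) =
      inj₁ (confined Zp Zp⊂X (green p) λ {v} v∈X v≢0 v~p → let s = proj₁ (to-H v∈X) in
        in-Zp v∈X (component-in-Z′ v∈X λ h≢0 → class (proj₂ (to-H v∈X)) h≢0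
          (dec-true (sees? col p (v +v s · p)) (- s , trans (cong green (affine-cancel s v p)) v~p))))
      where
      open Lifted Z′ Z′⊆H w w∈H w∉Z′
    lift-confined (confined Z′ (Z′⊆H , w , w∈H , w∉Z′) false class) =
      inj₂ (repeats Zp Zp⊂X (in-Zp p∈X (- 1# , subst (_∈ Z′) (sym (+v-inverseʳ p)) (has-0 Z′))) again)
      where
      open Lifted Z′ Z′⊆H w w∈H w∉Z′
      again : ∀ {x} → x ∈ X → x ∉ Zp → ∃ λ t → green (x +v t · p) ≡ green p
      again {x} x∈X x∉Zp = let (t , same) = dec-true⁻ (sees? col p h) sees-h in
        s + t , trans (cong green (sym (affine-shift s t x p))) same
        where
        s = proj₁ (to-H x∈X)
        h = x +v s · p
        sees-h : does (sees? col p h) ≡ true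
        sees-h = ¬-not λ blind →
          ∈⇒¬∉ {Zp} (in-Zp x∈X (component-in-Z′ x∈X λ h≢0 → class (proj₂ (to-H x∈X)) h≢0 blind)) x∉Zp

  -- Take x outside Zg and Zy. The line through g and x has two green points x + t₁ g, x + t₂ g
  -- besides g. Shifting them by τ y with x + τ y ∉ Zg turns both red, since g ∈ Zy and each shifted
  -- point lies on a line through y outside Zy; so the line through g and x + τ y is mixed.
  module Clash {col : Colouring} {X : Subspace} (2<q : 2 < q) (noMixed : ¬ MixedLine col X)
    {g y : V} (g∈X : g ∈ X) (g≢0 : g ≢ 0v) (y∈X : y ∈ X) (y≢0 : y ≢ 0v)
    (green-g : Colouring.green col g ≡ true) (red-y : Colouring.green col y ≡ false)
    (Rg : Repeats col X g) (Ry : Repeats col X y) (y∉Zg : y ∉ Repeats.Z Rg) where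

    open Colouring col
    open Repeats Rg using () renaming (Z to Zg; Z⊂X to Zg⊂X; p∈Z to g∈Zg; again to again-g)
    open Repeats Ry using () renaming (Z to Zy; Z⊂X to Zy⊂X; p∈Z to y∈Zy; again to again-y)

    Igy : Indep g y
    Igy = colours-Indep col g≢0 y≢0 λ same → true≢false (trans (sym green-g) (trans same red-y))

    g∈Zy : g ∈ Zy
    g∈Zy = ¬-not λ g∉Zy →
      let (t , green-y+tg) = again-g y∈X y∉Zg
          (s , red-g+sy) = again-y g∈X g∉Zy
      in noMixed (mixedLine g∈X y∈X Igy
           (pair (∈⟨⟩-left g y) (∈⟨⟩-shiftˡ g y t) (Indep-shift t Igy) green-g (trans green-y+tg green-g))
           (pair (∈⟨⟩-right g y) (∈⟨⟩-shiftʳ g y s) (Indep-shift s (Indep-sym Igy)) red-y (trans red-g+sy red-y)))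

    one-red-off-Zg : ∀ {x u u′} → x ∈ X → x ∉ Zg → u ≢ u′ →
      green (x +v u · g) ≡ false → green (x +v u′ · g) ≡ false → ⊥
    one-red-off-Zg {x} {u} {u′} x∈X x∉Zg u≢u′ red-u red-u′ =
      let (t , green-x+tg) = again-g x∈X x∉Zg
      in noMixed (mixedLine g∈X x∈X Igx
           (pair (∈⟨⟩-left g x) (∈⟨⟩-shiftˡ g x t) (Indep-shift t Igx) green-g (trans green-x+tg green-g))
           (pair (∈⟨⟩-shiftˡ g x u) (∈⟨⟩-shiftˡ g x u′) (Indep-affine Igx u≢u′) red-u red-u′))
      where
      Igx = ∈-∉-Indep Zg g≢0 g∈Zg x∉Zg

    another-green : ∀ {x} → x ∈ X → x ∉ Zg → ∀ t → ∃ λ t′ → t′ ≢ t × green (x +v t′ · g) ≡ true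
    another-green {x} x∈X x∉Zg t with u , u′ , u≢u′ , u≢t , u′≢t ← two-others 2<q t
      with green (x +v u · g) in colour-u | green (x +v u′ · g) in colour-u′
    ... | true | _ = u , u≢t , colour-u
    ... | false | true = u′ , u′≢t , colour-u′
    ... | false | false = ⊥-elim (one-red-off-Zg x∈X x∉Zg u≢u′ colour-u colour-u′)

    shift-off-Zg : ∀ {x} → ∃ λ τ → τ ≢ 0# × x +v τ · y ∉ Zg
    shift-off-Zg {x} with τ₁ , τ₂ , τ₁≢τ₂ , τ₁≢0 , τ₂≢0 ← two-others 2<q 0#
      with member Zg (x +v τ₁ · y) in m₁ | member Zg (x +v τ₂ · y) in m₂
    ... | false | _ = τ₁ , τ₁≢0 , m₁
    ... | true | false = τ₂ , τ₂≢0 , m₂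
    ... | true | true = ⊥-elim (∈⇒¬∉ {Zg} (affine-two-points Zg τ₁≢τ₂ m₁ m₂) y∉Zg)

    turns-red : ∀ {x τ t} → x ∈ X → x ∉ Zy → τ ≢ 0# →
      green (x +v t · g) ≡ true → green ((x +v τ · y) +v t · g) ≡ false
    turns-red {x} {τ} {t} x∈X x∉Zy τ≢0 green-a = ¬-not λ green-a′ →
      let (s , red-a+sy) = again-y a∈X a∉Zy
      in noMixed (mixedLine y∈X a∈X Iya
           (pair (∈⟨⟩-right y a) (∈⟨⟩-shiftˡ y a τ) Iaτ green-a
                 (trans (cong green (sym (affine-swap τ t x y g))) green-a′))
           (pair (∈⟨⟩-left y a) (∈⟨⟩-shiftˡ y a s) (Indep-shift s Iya) red-y (trans red-a+sy red-y)))
      where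
      a = x +v t · g
      a∈X = affine-∈ X t x∈X g∈X
      a∉Zy = affine-∉ Zy t x∉Zy g∈Zy
      Iya = ∈-∉-Indep Zy y≢0 y∈Zy a∉Zy
      Iaτ : Indep a (a +v τ · y)
      Iaτ = subst (λ v → Indep v (a +v τ · y)) (affine-0 a y) (Indep-affine Iya (λ 0≡τ → τ≢0 (sym 0≡τ)))

    clash : ⊥
    clash =
      let (x , x∈X , x∉Zg , x∉Zy) = avoid-two {Zg} {Zy} {X} Zg⊂X Zy⊂X
          (t₁ , green₁) = again-g x∈X x∉Zg
          (t₂ , t₂≢t₁ , green₂) = another-green x∈X x∉Zg t₁
          (τ , τ≢0 , x′∉Zg) = shift-off-Zg {x}
      in one-red-off-Zg (affine-∈ X τ x∈X y∈X) x′∉Zg t₂≢t₁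
           (turns-red x∈X x∉Zy τ≢0 green₂) (turns-red x∈X x∉Zy τ≢0 (trans green₁ green-g))

  ConfinedBelow : Subspace → Set c
  ConfinedBelow X = ∀ {Y} → Y ⊂ X → ∀ col → ¬ MixedLine col Y → NonZero Y → Confined col Y

  confined-or-repeats : ∀ {col X p o} → ConfinedBelow X →
    ¬ MixedLine col X → p ∈ X → p ≢ 0v → o ∈ X → o ≢ 0v → Colouring.green col o ≢ Colouring.green col p →
    Confined col X ⊎ Repeats col X p
  confined-or-repeats {col} {X} {p} IH noMixed p∈X p≢0 o∈X o≢0 o≁p =
    lift-confined (IH H⊂X (projection col p) (projection-noMixedLine pᵢ≢0 p∈X noMixed) (H-nonzero o∈X o≢0 o≁p))
    where open AtPoint {col} {X} {p} p∈X p≢0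

  confinement-step : 2 < q → ∀ {col X} → ConfinedBelow X → ¬ MixedLine col X → NonZero X → Confined col X
  confinement-step 2<q {col} {X} IH noMixed (w , w∈X , w≢0)
    with ∃v? (λ v → (member X v Bool.≟ true) ×-dec ¬? (v ≟v 0v) ×-dec (Colouring.green col v Bool.≟ true))
       | ∃v? (λ v → (member X v Bool.≟ true) ×-dec ¬? (v ≟v 0v) ×-dec (Colouring.green col v Bool.≟ false))
  ... | no no-green | _ =
    confined zeroSubspace (zero⊂ {X} w∈X w≢0) true λ v∈X v≢0 green-v → ⊥-elim (no-green (_ , v∈X , v≢0 , green-v))
  ... | yes _ | no no-red =
    confined zeroSubspace (zero⊂ {X} w∈X w≢0) false λ v∈X v≢0 red-v → ⊥-elim (no-red (_ , v∈X , v≢0 , red-v))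
  ... | yes (g , g∈X , g≢0 , green-g) | yes (y₀ , y₀∈X , y₀≢0 , red-y₀)
    with confined-or-repeats IH noMixed g∈X g≢0 y₀∈X y₀≢0
           (λ same → true≢false (trans (sym green-g) (trans (sym same) red-y₀)))
  ...   | inj₁ done = done
  ...   | inj₂ Rg with ∃v? (λ v → (member X v Bool.≟ true) ×-dec ¬? (v ≟v 0v) ×-dec
                               (Colouring.green col v Bool.≟ false) ×-dec (member (Repeats.Z Rg) v Bool.≟ false))
  ...     | no none = confined (Repeats.Z Rg) (Repeats.Z⊂X Rg) false
                        λ v∈X v≢0 red-v → ¬-not λ v∉Zg → none (_ , v∈X , v≢0 , red-v , v∉Zg)
  ...     | yes (y , y∈X , y≢0 , red-y , y∉Zg)
    with confined-or-repeats IH noMixed y∈X y≢0 g∈X g≢0 (λ same → true≢false (trans (sym green-g) (trans same red-y)))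
  ...       | inj₁ done = done
  ...       | inj₂ Ry = ⊥-elim (Clash.clash 2<q noMixed g∈X g≢0 y∈X y≢0 green-g red-y Rg Ry y∉Zg)

  confinement : 2 < q → ∀ {col X} → Acc _⊂_ X → ¬ MixedLine col X → NonZero X → Confined col X
  confinement 2<q (acc smaller) = confinement-step 2<q λ Y⊂X col → confinement 2<q (smaller Y⊂X)

module Filtrations {c} (K : Field c) {q} (ord : HasOrder K q) (r : ℕ) where

  open Vectors K
  open ColouredSubspaces K r
  open FiniteField K ord
  open FiniteSubspaces K ord r
  open Confinement K ord r
  open Geometry K r using (V; Colouring; Subspace; member; IsTarget)

  even : ℕ → Bool
  even zero = true
  even (suc n) = not (even n)

  even-at-least : ∀ k β → ∃ λ t → k ≤ t × even t ≡ β
  even-at-least k β with even k Bool.≟ β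
  ... | yes even-k = k , ℕ.≤-refl , even-k
  ... | no ¬even-k = suc k , ℕ.n≤1+n k , trans (cong not (¬-not ¬even-k)) (not-involutive β)

  -- The chain of flats of a target of X, indexed by ℕ and equal to X from length on.
  record Filtration (col : Colouring) (X : Subspace) : Set c where
    open Colouring col
    field
      length : ℕ
      layer : ℕ → Subspace
      bottom : ∀ {v} → v ∈ layer 0 → v ≡ 0v
      nested : ∀ n → layer n ⊆ layer (suc n)
      inside : ∀ n → layer n ⊆ X
      top : ∀ {n} → length ≤ n → ∀ v → member (layer n) v ≡ member X v
      parity : ∀ {i v} → v ≢ 0v → v ∉ layer i → v ∈ layer (suc i) → green v ≡ even i

  -- The chain of Z is continued by copies of Z up to an index t whose parity matches the colour
  -- (not colour) of the points of X − Z, and then ends with X.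
  module Extension {col X} (C : Confined col X) (F : Filtration col (Confined.Z C)) where

    open Colouring col
    open Confined C
    open Filtration F

    private
      t = proj₁ (even-at-least length (not colour))
      length≤t = proj₁ (proj₂ (even-at-least length (not colour)))
      even-t = proj₂ (proj₂ (even-at-least length (not colour)))

    layer′ : ℕ → Subspace
    layer′ n with n ℕ.≤? t
    ... | yes _ = layer n
    ... | no _ = X

    below : ∀ {n} → n ≤ t → layer′ n ≡ layer n
    below {n} n≤t with n ℕ.≤? t
    ... | yes _ = refl
    ... | no n≰t = ⊥-elim (n≰t n≤t)

    above : ∀ {n} → t < n → layer′ n ≡ X
    above {n} t<n with n ℕ.≤? t
    ... | yes n≤t = ⊥-elim (ℕ.<⇒≱ t<n n≤t)
    ... | no _ = refl

    inside′ : ∀ n → layer′ n ⊆ X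
    inside′ n with n ℕ.≤? t
    ... | yes _ = proj₁ Z⊂X ∘ inside n
    ... | no _ = λ v∈X → v∈X

    nested′ : ∀ n → layer′ n ⊆ layer′ (suc n)
    nested′ n {v} = [ low , high ]′ (ℕ.≤-<-connex (suc n) t)
      where
      low : suc n ≤ t → v ∈ layer′ n → v ∈ layer′ (suc n)
      low 1+n≤t = subst (v ∈_) (sym (below 1+n≤t)) ∘ nested n ∘ subst (v ∈_) (below (ℕ.<⇒≤ 1+n≤t))
      high : t < suc n → v ∈ layer′ n → v ∈ layer′ (suc n)
      high t<1+n = subst (v ∈_) (sym (above t<1+n)) ∘ inside′ n

    parity′ : ∀ {i v} → v ≢ 0v → v ∉ layer′ i → v ∈ layer′ (suc i) → green v ≡ even i
    parity′ {i} {v} v≢0 v∉ v∈ =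
      [ low , (λ t<1+i → [ high t<1+i , last ]′ (ℕ.m≤n⇒m<n∨m≡n (ℕ.≤-pred t<1+i))) ]′ (ℕ.≤-<-connex (suc i) t)
      where
      low : suc i ≤ t → green v ≡ even i
      low 1+i≤t = parity v≢0 (subst (v ∉_) (below (ℕ.<⇒≤ 1+i≤t)) v∉) (subst (v ∈_) (below 1+i≤t) v∈)
      high : t < suc i → t < i → green v ≡ even i
      high t<1+i t<i = ⊥-elim (∈⇒¬∉ {X} (subst (v ∈_) (above t<1+i) v∈) (subst (v ∉_) (above t<i) v∉))
      last : t ≡ i → green v ≡ even i
      last refl = trans (¬-not λ coloured → ∈⇒¬∉ {Z} (class⊆Z v∈X v≢0 coloured) v∉Z) (sym even-t)
        where
        v∈X = subst (v ∈_) (above (ℕ.n<1+n t)) v∈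
        v∉Z : v ∉ Z
        v∉Z = trans (sym (top length≤t v)) (subst (v ∉_) (below ℕ.≤-refl) v∉)

    extended : Filtration col X
    extended = record
      { length = suc t
      ; layer = layer′
      ; bottom = λ {v} v∈ → bottom (subst (v ∈_) (below ℕ.z≤n) v∈)
      ; nested = nested′
      ; inside = inside′
      ; top = λ {n} 1+t≤n v → cong (λ L → member L v) (above 1+t≤n)
      ; parity = parity′
      }

  trivial-filtration : ∀ {col X} → (∀ {v} → v ∈ X → v ≡ 0v) → Filtration col X
  trivial-filtration {X = X} trivial = record
    { length = 0
    ; layer = λ _ → X
    ; bottom = trivial
    ; nested = λ _ v∈X → v∈X
    ; inside = λ _ v∈X → v∈X
    ; top = λ _ _ → refl
    ; parity = λ {_} {v} v≢0 _ v∈X → ⊥-elim (v≢0 (trivial v∈X))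
    }

  filtration : 2 < q → ∀ {col X} → Acc _⊂_ X → ¬ MixedLine col X → Filtration col X
  filtration 2<q {col} {X} (acc smaller) noMixed with ∃v? (λ v → (member X v Bool.≟ true) ×-dec ¬? (v ≟v 0v))
  ... | no zero-only = trivial-filtration λ {v} v∈X → decidable-stable (v ≟v 0v) λ v≢0 → zero-only (v , v∈X , v≢0)
  ... | yes nonzero =
    Extension.extended C (filtration 2<q (smaller (Confined.Z⊂X C)) (noMixed ∘ MixedLine-⊆ (proj₁ (Confined.Z⊂X C))))
    where C = confinement 2<q (acc smaller) noMixed nonzero

  even⇒%2≡0 : ∀ n → even n ≡ true → n % 2 ≡ 0
  even⇒%2≡0 zero _ = refl
  even⇒%2≡0 (suc (suc n)) even-n = even⇒%2≡0 n (trans (sym (not-involutive (even n))) even-n)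

  %2≡0⇒even : ∀ n → n % 2 ≡ 0 → even n ≡ true
  %2≡0⇒even zero _ = refl
  %2≡0⇒even (suc (suc n)) n%2≡0 = trans (not-involutive (even n)) (%2≡0⇒even n n%2≡0)

  filtration⇒target : ∀ {col} → Filtration col fullSubspace → IsTarget col
  filtration⇒target {col} F = length , W , (λ v → bottom {v}) , reaches-top , step , colours
    where
    open Filtration F
    open Colouring col
    W : Fin (suc length) → Subspace
    W i = layer (toℕ i)
    reaches-top : ∀ v → member (W (Fin.fromℕ length)) v ≡ true
    reaches-top v = trans (top (ℕ.≤-reflexive (sym (Fin.toℕ-fromℕ length))) v) (Full.∈⁺ {v} tt)
    step : ∀ (i : Fin length) v → member (W (Fin.inject₁ i)) v ≡ true → member (W (Fin.suc i)) v ≡ true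
    step i v = nested (toℕ i) ∘ subst (λ n → v ∈ layer n) (Fin.toℕ-inject₁ i)
    EvenEntry : V → Set
    EvenEntry v =
      Σ (Fin length) λ i → toℕ i % 2 ≡ 0 × member (W (Fin.inject₁ i)) v ≡ false × member (W (Fin.suc i)) v ≡ true
    colours : ∀ v → v ≢ 0v → (green v ≡ true → EvenEntry v) × (EvenEntry v → green v ≡ true)
    colours v v≢0 = enters , colour-of-entry
      where
      enters : green v ≡ true → EvenEntry v
      enters green-v =
        let (i , i<length , v∉ , v∈) = rising-edge (λ n → member (layer n) v)
              (¬∈⇒∉ {layer 0} {v} λ v∈ → v≢0 (bottom v∈)) length (trans (top ℕ.≤-refl v) (Full.∈⁺ {v} tt))
            toℕ-i = Fin.toℕ-fromℕ< i<length
        in Fin.fromℕ< i<length ,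
           subst (λ n → n % 2 ≡ 0) (sym toℕ-i) (even⇒%2≡0 i (trans (sym (parity v≢0 v∉ v∈)) green-v)) ,
           subst (λ n → v ∉ layer n) (sym (trans (Fin.toℕ-inject₁ _) toℕ-i)) v∉ ,
           subst (λ n → v ∈ layer (suc n)) (sym toℕ-i) v∈
      colour-of-entry : EvenEntry v → green v ≡ true
      colour-of-entry (i , i%2≡0 , v∉ , v∈) =
        trans (parity v≢0 (subst (λ n → v ∉ layer n) (Fin.toℕ-inject₁ i) v∉) v∈) (%2≡0⇒even (toℕ i) i%2≡0)

theorem1p2 : ∀ {c : Level} (K : Field c) (q : ℕ) → HasOrder K q → 2 < q →
    (r : ℕ) → 1 ≤ r → (col : Geometry.Colouring K r) →
    Geometry.IsTarget K r col ⇔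
      (¬ (∃[ m ] (2 ≤ m × m ≤ q ∸ 1 × Geometry.HasInducedU2 K r col m)))
theorem1p2 K q ord 2<q r _ col = mk⇔
  (λ target (m , 2≤m , m≤q∸1 , U₂) → target⇒noMixedLine target (proj₂ (inducedU2⇒mixedLine col 2≤m m≤q∸1 U₂)))
  (λ noU₂ → filtration⇒target (filtration 2<q (⊂-wellFounded fullSubspace) (noU₂ ∘ mixedLine⇒inducedU2 col)))
  where
  open FiniteSubspaces K ord r
  open InducedU2 K ord r
  open Targets K r
  open Filtrations K ord r
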